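{- Let $L \xleftarrow{i_1} I \xrightarrow{i_2} R$ be a $!$-graph equation and let $b \in {!}(I)$. Then applying any of the $!$-box operations $\mathrm{COPY}$, $\mathrm{DROP}$, $\mathrm{KILL}$ at $b$ to it, i.e. forming $\mathrm{OP}_{i_1(b)}(L) \xleftarrow{\mathrm{OP}_{i_1(b)}(i_1)} \mathrm{OP}_b(I) \xrightarrow{\mathrm{OP}_{i_2(b)}(i_2)} \mathrm{OP}_{i_2(b)}(R)$ for $\mathrm{OP} \in \{\mathrm{COPY},\mathrm{DROP},\mathrm{KILL}\}$, yields another $!$-graph equation.
   Context: Fix a compressed monoidal signature $T=(O,M,\mathrm{dom},\mathrm{cod})$, $\mathrm{dom},\mathrm{cod}: M \rightarrow (O\times\{\mathsf{v},\mathsf{f}\})^*$. The derived compressed typegraph $\mathcal{G}_T$ has vertex set $O\sqcup M$, a self-loop on each $X\in O$, an edge $\mathrm{in}^a_{f,i}$ from $X$ to $f$ for each $f\in M$ and index $i$ with $\mathrm{dom}(f)[i]=(X,a)$, and an edge $\mathrm{out}^a_{f,j}$ from $f$ to $X$ for each index $j$ with $\mathrm{cod}(f)[j]=(X,a)$. $\mathcal{G}_{T!}$ is $\mathcal{G}_T$ plus a vertex $!$, a self-loop on $!$, and an edge from $!$ to each vertex of $\mathcal{G}_T$. For a finite directed multigraph $G$ typed over $\mathcal{G}_{T!}$, vertices typed in $O$, $M$, $!$ are wire-, node-, $!$-vertices ($!(G)$ the set of $!$-vertices); fixed-arity edges are those typed by an $\mathsf{f}$-tagged edge; $U(G)$ deletes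 $!$-vertices and incident edges. A string graph is a $\mathcal{G}_T$-typed graph whose typing restricts at each node-vertex to a bijection on incident fixed-arity edges and whose wire-vertices have at most one incoming and one outgoing edge; inputs (outputs) are wire-vertices with no incoming (outgoing) edge. An open subgraph $O'$ of a string graph $K$ is a string subgraph with no vertex adjacent to a wire-vertex outside $O'$ and no incident fixed-arity edge outside $O'$. $B(b)$ is the full subgraph on successors of a $!$-vertex $b$, $\beta(G)$ the full subgraph on $!$-vertices. A $!$-graph is a $\mathcal{G}_{T!}$-typed graph with $U(G)$ a string graph, $\beta(G)$ posetal (at most one edge between two vertices, edge relation a partial order), $U(B(b))$ open in $U(G)$ for each $!$-vertex $b$, and $B(b')\subseteq B(b)$ whenever $b'\in B(b)$; $\mathbf{BGraph}_T$ is the full subcategory of $\mathbf{Graph}/\mathcal{G}_{T!}$ on $!$-graphs. $G\setminus H$ is the full subgraph on vertices not in $H$. Operations on $!$-graphs: $\mathrm{COPY}_b(G)$ is the pushout in $\mathbf{Graph}/\mathcal{G}_{T!}$ of $G \hookleftarrow G\setminus B(b) \hookrightarrow G$, with coprojections $p^G_1,p^G_2 : G \rightarrow \mathrm{COPY}_b(G)$; $\mathrm{DROP}_b(G)=G\setminus\{b\}$; $\mathrm{KILL}_b(G)=G\setminus B(b)$. $\mathrm{In}_!(G)$ (resp. $\mathrm{Out}_!(G)$) is the full subgraph on $!(G)$ and the inputs (resp. outputs) of $U(G)$; $\mathrm{Bound}_!(G)$ is the subgraph with vertices $!(G)$ and the inputs and outputs of $U(G)$, and edges those whose source is a $!$-vertex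 and target one of these vertices. A $!$-graph monomorphism $f: G\rightarrow H$ reflects $!$-box containment if every edge of $H$ from a $!$-vertex to a vertex in the image of $f$ is in the image of $f$. For such $f$ and $b \in !(G)$: $\mathrm{DROP}_{f(b)}(f) : \mathrm{DROP}_b(G)\rightarrow \mathrm{DROP}_{f(b)}(H)$ and $\mathrm{KILL}_{f(b)}(f) : \mathrm{KILL}_b(G)\rightarrow \mathrm{KILL}_{f(b)}(H)$ are the restrictions of $f$, and $\mathrm{COPY}_{f(b)}(f) : \mathrm{COPY}_b(G) \rightarrow \mathrm{COPY}_{f(b)}(H)$ is the unique morphism with $\mathrm{COPY}_{f(b)}(f)\circ p^G_k = p^H_k \circ f$ for $k=1,2$ (these are well-defined monomorphisms reflecting $!$-box containment). A $!$-graph equation is a span $L\xleftarrow{i_1} I \xrightarrow{i_2} R$ in $\mathbf{BGraph}_T$ such that: $U(L)$ and $U(R)$ have no isolated wire-vertices; there are isomorphisms $\phi_I : \mathrm{In}_!(L)\cong \mathrm{In}_!(R)$, $\phi_O : \mathrm{Out}_!(L)\cong\mathrm{Out}_!(R)$, $\phi_L:\mathrm{Bound}_!(L)\cong I$, $\phi_R:\mathrm{Bound}_!(R)\cong I$ such that, writing $j_1,j_2$ for $\phi_L$, resp. $\phi_R$, composed with the inclusions $\mathrm{In}_!(L)\hookrightarrow \mathrm{Bound}_!(L)$, resp. $\mathrm{In}_!(R)\hookrightarrow\mathrm{Bound}_!(R)$, and $k_1,k_2$ likewise for $\mathrm{Out}_!$, we have $i_1\circ j_1$ and $i_2 \circ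 j_2$ equal to the inclusions of $\mathrm{In}_!(L)$ into $L$ and of $\mathrm{In}_!(R)$ into $R$, $j_2\circ\phi_I = j_1$, and analogously $i_1\circ k_1$, $i_2\circ k_2$ are the inclusions of $\mathrm{Out}_!$ and $k_2\circ \phi_O = k_1$. -}

module Defs where

open import Data.Bool using (Bool; true; false; T; _∧_; _∨_; not)
open import Data.Empty using (⊥; ⊥-elim)
open import Data.Unit using (⊤; tt)
open import Data.Fin using (Fin)
open import Data.List using (List; []; _∷_; length; lookup; map; _++_)
open import Data.Bool.ListAction using (any)
open import Data.List.Membership.Propositional using (_∈_)
open import Data.List.Membership.Propositional.Properties using (∈-map⁺; ∈-++⁺ˡ; ∈-++⁺ʳ)
open import Data.List.Relation.Unary.Any using (here; there)
open import Data.Product using (Σ; _×_; _,_; proj₁; proj₂; ∃)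
open import Data.Sum using (_⊎_; inj₁; inj₂)
import Data.Sum.Properties as SumP
open import Function using (_∘_)
open import Relation.Binary.Definitions using (DecidableEquality)
open import Relation.Binary.PropositionalEquality using (_≡_; refl; sym; trans; cong; subst)
open import Relation.Nullary using (yes; no; ¬_)
open import Relation.Nullary.Decidable using (⌊_⌋)

T-irr : ∀ {c : Bool} (p q : T c) → p ≡ q
T-irr {true} tt tt = refl

∧-projˡ : ∀ a b → T (a ∧ b) → T a
∧-projˡ true b _ = tt

∧-projʳ : ∀ a b → T (a ∧ b) → T b
∧-projʳ true b p = p

Σ-T-dec : ∀ {A : Set} (P : A → Bool) → DecidableEquality A → DecidableEquality (Σ A (T ∘ P))
Σ-T-dec P d (x , p) (y , q) with d x y
... | yes refl = yes (cong (x ,_) (T-irr p q))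
... | no ne = no (λ eq → ne (cong proj₁ eq))

sieveAux : ∀ {A : Set} (P : A → Bool) (y : A) (c : Bool) → c ≡ P y →
           List (Σ A (T ∘ P)) → List (Σ A (T ∘ P))
sieveAux P y true eq rest = (y , subst T eq tt) ∷ rest
sieveAux P y false eq rest = rest

sieve : ∀ {A : Set} (P : A → Bool) → List A → List (Σ A (T ∘ P))
sieve P [] = []
sieve P (y ∷ ys) = sieveAux P y (P y) refl (sieve P ys)

sieveAux-here : ∀ {A : Set} (P : A → Bool) (y : A) (c : Bool) (eq : c ≡ P y) (p : T (P y)) rest →
                (y , p) ∈ sieveAux P y c eq rest
sieveAux-here P y true eq p rest = here (cong (y ,_) (T-irr _ _))
sieveAux-here P y false eq p rest = ⊥-elim (subst T (sym eq) p)

sieveAux-there : ∀ {A : Set} (P : A → Bool) (y : A) (c : Bool) (eq : c ≡ P y) {x} rest →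
                 x ∈ rest → x ∈ sieveAux P y c eq rest
sieveAux-there P y true eq rest m = there m
sieveAux-there P y false eq rest m = m

sieve-complete : ∀ {A : Set} (P : A → Bool) {x : A} (p : T (P x)) (xs : List A) → x ∈ xs → (x , p) ∈ sieve P xs
sieve-complete P p (y ∷ ys) (here refl) = sieveAux-here P y (P y) refl p (sieve P ys)
sieve-complete P p (y ∷ ys) (there m) = sieveAux-there P y (P y) refl (sieve P ys) (sieve-complete P p ys m)

data Tag : Set where
  𝗏 𝖿 : Tag    -- variable-arity / fixed-arity

record Sig : Set₁ where
  field
    O M : Set
    dom cod : M → List (O × Tag)
open Sig public

module _ (T' : Sig) where

  data TV : Set where
    wireT : O T' → TV
    nodeT : M T' → TV
    bangT : TV

  data TE : Set where
    loopT : O T' → TE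
    inT : (f : M T') → Fin (length (dom T' f)) → TE
    outT : (f : M T') → Fin (length (cod T' f)) → TE
    bangLoopT : TE
    bangToWireT : O T' → TE
    bangToNodeT : M T' → TE

  srcT : TE → TV
  srcT (loopT X) = wireT X
  srcT (inT f i) = wireT (proj₁ (lookup (dom T' f) i))
  srcT (outT f j) = nodeT f
  srcT bangLoopT = bangT
  srcT (bangToWireT X) = bangT
  srcT (bangToNodeT f) = bangT

  tgtT : TE → TV
  tgtT (loopT X) = wireT X
  tgtT (inT f i) = nodeT f
  tgtT (outT f j) = wireT (proj₁ (lookup (cod T' f) j))
  tgtT bangLoopT = bangT
  tgtT (bangToWireT X) = wireT X
  tgtT (bangToNodeT f) = nodeT f

  isFixedT : TE → Bool
  isFixedT (inT f i) with proj₂ (lookup (dom T' f) i)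
  ... | 𝖿 = true
  ... | 𝗏 = false
  isFixedT (outT f j) with proj₂ (lookup (cod T' f) j)
  ... | 𝖿 = true
  ... | 𝗏 = false
  isFixedT _ = false

  -- finite directed multigraphs typed over 𝒢_{T!}
  -- (finiteness: decidable equality + complete enumeration of vertices and edges)
  record TGraph : Set₁ where
    field
      V E : Set
      src tgt : E → V
      tyV : V → TV
      tyE : E → TE
      src-ty : ∀ e → srcT (tyE e) ≡ tyV (src e)
      tgt-ty : ∀ e → tgtT (tyE e) ≡ tyV (tgt e)
      decV : DecidableEquality V
      decE : DecidableEquality E
      enumV : List V
      enumV-complete : ∀ v → v ∈ enumV
      enumE : List E
      enumE-complete : ∀ e → e ∈ enumE

open TGraph public

isWireT : ∀ {T'} → TV T' → Bool
isWireT (wireT _) = true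
isWireT _ = false

isNodeT : ∀ {T'} → TV T' → Bool
isNodeT (nodeT _) = true
isNodeT _ = false

isBangT : ∀ {T'} → TV T' → Bool
isBangT bangT = true
isBangT _ = false

module _ {T' : Sig} where

  record Hom (G H : TGraph T') : Set where
    field
      fV : V G → V H
      fE : E G → E H
      src-comm : ∀ e → src H (fE e) ≡ fV (src G e)
      tgt-comm : ∀ e → tgt H (fE e) ≡ fV (tgt G e)
      tyV-comm : ∀ v → tyV H (fV v) ≡ tyV G v
      tyE-comm : ∀ e → tyE H (fE e) ≡ tyE G e
  open Hom public

  _∘H_ : ∀ {G H K : TGraph T'} → Hom H K → Hom G H → Hom G K
  g ∘H f = record
    { fV = fV g ∘ fV f
    ; fE = fE g ∘ fE f
    ; src-comm = λ e → trans (src-comm g (fE f e)) (cong (fV g) (src-comm f e))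
    ; tgt-comm = λ e → trans (tgt-comm g (fE f e)) (cong (fV g) (tgt-comm f e))
    ; tyV-comm = λ v → trans (tyV-comm g (fV f v)) (tyV-comm f v)
    ; tyE-comm = λ e → trans (tyE-comm g (fE f e)) (tyE-comm f e)
    }

  _≈H_ : ∀ {G H : TGraph T'} → Hom G H → Hom G H → Set
  f ≈H g = (∀ v → fV f v ≡ fV g v) × (∀ e → fE f e ≡ fE g e)

  record Iso (G H : TGraph T') : Set where
    field
      to : Hom G H
      from : Hom H G
      from-to-V : ∀ v → fV from (fV to v) ≡ v
      from-to-E : ∀ e → fE from (fE to e) ≡ e
      to-from-V : ∀ v → fV to (fV from v) ≡ v
      to-from-E : ∀ e → fE to (fE from e) ≡ e
  open Iso public

  Sub : (G : TGraph T') → (V G → Bool) → (E G → Bool) → TGraph T'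
  Sub G P Q = record
    { V = Σ (V G) (T ∘ P)
    ; E = Σ (E G) (λ e → T (Q e ∧ P (src G e) ∧ P (tgt G e)))
    ; src = λ { (e , q) → src G e , ∧-projˡ (P (src G e)) (P (tgt G e)) (∧-projʳ (Q e) _ q) }
    ; tgt = λ { (e , q) → tgt G e , ∧-projʳ (P (src G e)) (P (tgt G e)) (∧-projʳ (Q e) _ q) }
    ; tyV = λ { (v , _) → tyV G v }
    ; tyE = λ { (e , _) → tyE G e }
    ; src-ty = λ { (e , _) → src-ty G e }
    ; tgt-ty = λ { (e , _) → tgt-ty G e }
    ; decV = Σ-T-dec P (decV G)
    ; decE = Σ-T-dec QE (decE G)
    ; enumV = sieve P (enumV G)
    ; enumV-complete = λ { (v , p) → sieve-complete P p (enumV G) (enumV-complete G v) }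
    ; enumE = sieve QE (enumE G)
    ; enumE-complete = λ { (e , p) → sieve-complete QE p (enumE G) (enumE-complete G e) }
    }
    where
      QE : E G → Bool
      QE e = Q e ∧ P (src G e) ∧ P (tgt G e)

  Full : (G : TGraph T') → (V G → Bool) → TGraph T'
  Full G P = Sub G P (λ _ → true)

  incl : (G : TGraph T') (P : V G → Bool) (Q : E G → Bool) → Hom (Sub G P Q) G
  incl G P Q = record
    { fV = proj₁ ; fE = proj₁
    ; src-comm = λ _ → refl ; tgt-comm = λ _ → refl
    ; tyV-comm = λ _ → refl ; tyE-comm = λ _ → refl }

  module _ (G : TGraph T') where

    isBangV isWireV isNodeV : V G → Bool
    isBangV v = isBangT (tyV G v)
    isWireV v = isWireT (tyV G v)
    isNodeV v = isNodeT (tyV G v)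

    inB : V G → V G → Bool
    inB b v = any (λ e → ⌊ decV G (src G e) b ⌋ ∧ ⌊ decV G (tgt G e) v ⌋) (enumE G)

    U : TGraph T'
    U = Full G (not ∘ isBangV)

    β : TGraph T'
    β = Full G isBangV

    B : V G → TGraph T'
    B b = Full G (inB b)

    -- inputs / outputs of U(G): wire-vertices with no incoming / outgoing edge in U(G)
    isInput isOutput : V G → Bool
    isInput v = isWireV v ∧ not (any (λ e → ⌊ decV G (tgt G e) v ⌋ ∧ not (isBangV (src G e))) (enumE G))
    isOutput v = isWireV v ∧ not (any (λ e → ⌊ decV G (src G e) v ⌋ ∧ not (isBangV (tgt G e))) (enumE G))

    inP outP boundP : V G → Bool
    inP v = isBangV v ∨ isInput v
    outP v = isBangV v ∨ isOutput v
    boundP v = isBangV v ∨ isInput v ∨ isOutput v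

    allE boundE : E G → Bool
    allE _ = true
    boundE e = isBangV (src G e)

    In! Out! Bound! : TGraph T'
    In! = Sub G inP allE
    Out! = Sub G outP allE
    Bound! = Sub G boundP boundE

  Incident : (G : TGraph T') → V G → E G → Set
  Incident G n e = src G e ≡ n ⊎ tgt G e ≡ n

  IsFixed : (G : TGraph T') → E G → Set
  IsFixed G e = T (isFixedT T' (tyE G e))

  IsStringGraph : TGraph T' → Set
  IsStringGraph G =
    -- typed over 𝒢_T (no !-typed vertices, hence no !-typed edges)
    (∀ v → ¬ T (isBangV G v)) ×
    (∀ n → T (isNodeV G n) →
      (∀ e e' → IsFixed G e → IsFixed G e' → Incident G n e → Incident G n e' →
         tyE G e ≡ tyE G e' → e ≡ e') ×
      (∀ (t : TE T') → T (isFixedT T' t) → (srcT T' t ≡ tyV G n ⊎ tgtT T' t ≡ tyV G n) →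
         ∃ λ e → Incident G n e × tyE G e ≡ t)) ×
    (∀ w → T (isWireV G w) →
      (∀ e e' → tgt G e ≡ w → tgt G e' ≡ w → e ≡ e') ×
      (∀ e e' → src G e ≡ w → src G e' ≡ w → e ≡ e'))

  IsOpenFull : (K : TGraph T') → (V K → Bool) → Set
  IsOpenFull K P =
    IsStringGraph (Full K P) ×
    (∀ v w e → T (P v) → ¬ T (P w) → T (isWireV K w) →
       ¬ ((src K e ≡ v × tgt K e ≡ w) ⊎ (src K e ≡ w × tgt K e ≡ v))) ×
    (∀ e → IsFixed K e → (T (P (src K e)) ⊎ T (P (tgt K e))) →
       T (P (src K e)) × T (P (tgt K e)))

  IsPosetal : TGraph T' → Set
  IsPosetal G =
    (∀ e e' → src G e ≡ src G e' → tgt G e ≡ tgt G e' → e ≡ e') ×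
    (∀ v → ∃ λ e → src G e ≡ v × tgt G e ≡ v) ×
    (∀ e e' → tgt G e ≡ src G e' → ∃ λ e'' → src G e'' ≡ src G e × tgt G e'' ≡ tgt G e') ×
    (∀ e e' → src G e ≡ tgt G e' → tgt G e ≡ src G e' → src G e ≡ tgt G e)

  IsBGraph : TGraph T' → Set
  IsBGraph G =
    IsStringGraph (U G) ×
    IsPosetal (β G) ×
    (∀ b → T (isBangV G b) → IsOpenFull (U G) (λ x → inB G b (proj₁ x))) ×
    (∀ b b' → T (isBangV G b) → T (isBangV G b') → T (inB G b b') →
       ∀ v → T (inB G b' v) → T (inB G b v))

  NoIsolatedWires : TGraph T' → Set
  NoIsolatedWires G = ∀ w → T (isWireV G w) → ∃ λ e → Incident G w e

  record IsEquation {L I R : TGraph T'} (i₁ : Hom I L) (i₂ : Hom I R) : Set where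
    field
      L-bgraph : IsBGraph L
      I-bgraph : IsBGraph I
      R-bgraph : IsBGraph R
      L-noIso : NoIsolatedWires (U L)
      R-noIso : NoIsolatedWires (U R)
      φI : Iso (In! L) (In! R)
      φO : Iso (Out! L) (Out! R)
      φL : Iso (Bound! L) I
      φR : Iso (Bound! R) I
      ιIL : Hom (In! L) (Bound! L)
      ιIR : Hom (In! R) (Bound! R)
      ιOL : Hom (Out! L) (Bound! L)
      ιOR : Hom (Out! R) (Bound! R)
      ιIL-incl : (incl L (boundP L) (boundE L) ∘H ιIL) ≈H incl L (inP L) (allE L)
      ιIR-incl : (incl R (boundP R) (boundE R) ∘H ιIR) ≈H incl R (inP R) (allE R)
      ιOL-incl : (incl L (boundP L) (boundE L) ∘H ιOL) ≈H incl L (outP L) (allE L)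
      ιOR-incl : (incl R (boundP R) (boundE R) ∘H ιOR) ≈H incl R (outP R) (allE R)
      -- j₁ = φL ∘ ι, j₂ = φR ∘ ι, k₁, k₂ likewise
      i₁j₁ : (i₁ ∘H (to φL ∘H ιIL)) ≈H incl L (inP L) (allE L)
      i₂j₂ : (i₂ ∘H (to φR ∘H ιIR)) ≈H incl R (inP R) (allE R)
      j₂φI : ((to φR ∘H ιIR) ∘H to φI) ≈H (to φL ∘H ιIL)
      i₁k₁ : (i₁ ∘H (to φL ∘H ιOL)) ≈H incl L (outP L) (allE L)
      i₂k₂ : (i₂ ∘H (to φR ∘H ιOR)) ≈H incl R (outP R) (allE R)
      k₂φO : ((to φR ∘H ιOR) ∘H to φO) ≈H (to φL ∘H ιOL)

  dropP : (G : TGraph T') → V G → V G → Bool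
  dropP G b v = not ⌊ decV G v b ⌋

  DROP : (G : TGraph T') → V G → TGraph T'
  DROP G b = Sub G (dropP G b) (allE G)

  killP : (G : TGraph T') → V G → V G → Bool
  killP G b v = not (inB G b v)

  KILL : (G : TGraph T') → V G → TGraph T'
  KILL G b = Sub G (killP G b) (allE G)

  -- COPY_b(G): explicit pushout of G ↩ G∖B(b) ↪ G.
  module _ (G : TGraph T') (b : V G) where

    touchB : E G → Bool
    touchB e = inB G b (src G e) ∨ inB G b (tgt G e)

    CV CE : Set
    CV = V G ⊎ Σ (V G) (T ∘ inB G b)
    CE = E G ⊎ Σ (E G) (T ∘ touchB)

    p2Vaux : (v : V G) (c : Bool) → c ≡ inB G b v → CV
    p2Vaux v true eq = inj₂ (v , subst T eq tt)
    p2Vaux v false _ = inj₁ v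

    -- second coprojection p₂ (on vertices / edges); the first is inj₁
    p2V : V G → CV
    p2V v = p2Vaux v (inB G b v) refl

    p2Eaux : (e : E G) (c : Bool) → c ≡ touchB e → CE
    p2Eaux e true eq = inj₂ (e , subst T eq tt)
    p2Eaux e false _ = inj₁ e

    p2E : E G → CE
    p2E e = p2Eaux e (touchB e) refl

    cTyV : CV → TV T'
    cTyV (inj₁ v) = tyV G v
    cTyV (inj₂ (v , _)) = tyV G v

    cSrc cTgt : CE → CV
    cSrc (inj₁ e) = inj₁ (src G e)
    cSrc (inj₂ (e , _)) = p2V (src G e)
    cTgt (inj₁ e) = inj₁ (tgt G e)
    cTgt (inj₂ (e , _)) = p2V (tgt G e)

    cTyE : CE → TE T'
    cTyE (inj₁ e) = tyE G e
    cTyE (inj₂ (e , _)) = tyE G e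

    p2V-ty : ∀ v c (eq : c ≡ inB G b v) → cTyV (p2Vaux v c eq) ≡ tyV G v
    p2V-ty v true eq = refl
    p2V-ty v false eq = refl

    cSrc-ty : ∀ e → srcT T' (cTyE e) ≡ cTyV (cSrc e)
    cSrc-ty (inj₁ e) = src-ty G e
    cSrc-ty (inj₂ (e , _)) = trans (src-ty G e) (sym (p2V-ty (src G e) _ refl))

    cTgt-ty : ∀ e → tgtT T' (cTyE e) ≡ cTyV (cTgt e)
    cTgt-ty (inj₁ e) = tgt-ty G e
    cTgt-ty (inj₂ (e , _)) = trans (tgt-ty G e) (sym (p2V-ty (tgt G e) _ refl))

    COPY : TGraph T'
    COPY = record
      { V = CV ; E = CE
      ; src = cSrc ; tgt = cTgt
      ; tyV = cTyV ; tyE = cTyE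
      ; src-ty = cSrc-ty ; tgt-ty = cTgt-ty
      ; decV = SumP.≡-dec (decV G) (Σ-T-dec _ (decV G))
      ; decE = SumP.≡-dec (decE G) (Σ-T-dec _ (decE G))
      ; enumV = map inj₁ (enumV G) ++ map inj₂ (sieve _ (enumV G))
      ; enumV-complete = λ
          { (inj₁ v) → ∈-++⁺ˡ (∈-map⁺ inj₁ (enumV-complete G v))
          ; (inj₂ (v , p)) → ∈-++⁺ʳ (map inj₁ (enumV G))
              (∈-map⁺ inj₂ (sieve-complete _ p (enumV G) (enumV-complete G v))) }
      ; enumE = map inj₁ (enumE G) ++ map inj₂ (sieve _ (enumE G))
      ; enumE-complete = λ
          { (inj₁ e) → ∈-++⁺ˡ (∈-map⁺ inj₁ (enumE-complete G e))
          ; (inj₂ (e , p)) → ∈-++⁺ʳ (map inj₁ (enumE G))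
              (∈-map⁺ inj₂ (sieve-complete _ p (enumE G) (enumE-complete G e))) }
      }

  IsCOPYMor : ∀ {G H : TGraph T'} (f : Hom G H) (b : V G) →
              Hom (COPY G b) (COPY H (fV f b)) → Set
  IsCOPYMor {G} {H} f b g =
    (∀ v → fV g (inj₁ v) ≡ inj₁ (fV f v)) ×
    (∀ e → fE g (inj₁ e) ≡ inj₁ (fE f e)) ×
    (∀ v → fV g (p2V G b v) ≡ p2V H (fV f b) (fV f v)) ×
    (∀ e → fE g (p2E G b e) ≡ p2E H (fV f b) (fE f e))

  IsRestriction : ∀ {G H : TGraph T'} (P : V G → Bool) (Q : E G → Bool)
                  (P' : V H → Bool) (Q' : E H → Bool) (f : Hom G H) →
                  Hom (Sub G P Q) (Sub H P' Q') → Set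
  IsRestriction {G} {H} P Q P' Q' f g = (incl H P' Q' ∘H g) ≈H (f ∘H incl G P Q)

module Submission where

-- IsEquation is phrased with Boolean predicates and explicit isomorphisms,
-- which are awkward to transport.  We first prove it equivalent to
-- EquationChar (equation⇒char, char⇒equation): L, I, R are !-graphs in
-- propositional form (BangGraph), wires of U(L), U(R) are not isolated,
-- each iₖ is a boundary embedding (injective, with image exactly the
-- boundary vertices and the edges from !-vertices into them), and i₁(x)
-- is an input/output of L iff i₂(x) is one of R.  The theorem then
-- reduces to the preservation of EquationChar:
--   * DROP and KILL are full subgraphs on vertex sets closed under
--     fixed-arity edges and wires, and restricting to such subgraphs
--     preserves EquationChar (restrictEquation);
--   * COPY_b(G) folds onto G by a map π that is injective on compatible
--     vertices and on the edges StringOn constrains, so all conditions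
--     lift along π (copy-bangGraph, copy-embedding, copyEquation).

open import Data.Bool using (Bool; true; false; T; _∧_; _∨_; not)
open import Data.Bool.Properties using (T-∧; T-∨; T?)
open import Data.Bool.ListAction using (any)
open import Data.Empty using (⊥; ⊥-elim)
open import Data.Unit using (⊤; tt)
open import Data.List.Membership.Propositional using (_∈_; lose)
open import Data.List.Relation.Unary.Any using (satisfied)
open import Data.List.Relation.Unary.Any.Properties using (any⁺; any⁻)
open import Data.Product using (Σ; _×_; _,_; proj₁; proj₂)
open import Data.Sum using (_⊎_; inj₁; inj₂) renaming (map to ⊎-map)
open import Function using (_∘_; id)
import Function.Bundles as Fun
open import Relation.Binary.PropositionalEquality using (_≡_; refl; sym; trans; cong; subst)
open import Relation.Nullary using (yes; no; ¬_)
open import Relation.Nullary.Decidable using (⌊_⌋; toWitness; fromWitness)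

open import Defs

∧-intro : ∀ {a b} → T a → T b → T (a ∧ b)
∧-intro {a} {b} p q = Fun.Equivalence.from (T-∧ {a} {b}) (p , q)

∧-fst : ∀ {a b} → T (a ∧ b) → T a
∧-fst {a} {b} p = proj₁ (Fun.Equivalence.to (T-∧ {a} {b}) p)

∧-snd : ∀ {a b} → T (a ∧ b) → T b
∧-snd {a} {b} p = proj₂ (Fun.Equivalence.to (T-∧ {a} {b}) p)

∨-cases : ∀ {a b} → T (a ∨ b) → T a ⊎ T b
∨-cases {a} {b} = Fun.Equivalence.to (T-∨ {a} {b})

∨-inl : ∀ {a b} → T a → T (a ∨ b)
∨-inl {a} {b} p = Fun.Equivalence.from (T-∨ {a} {b}) (inj₁ p)

∨-inr : ∀ {a b} → T b → T (a ∨ b)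
∨-inr {a} {b} p = Fun.Equivalence.from (T-∨ {a} {b}) (inj₂ p)

not-intro : ∀ {a} → ¬ T a → T (not a)
not-intro {true} n = n tt
not-intro {false} _ = tt

not-elim : ∀ {a} → T (not a) → ¬ T a
not-elim {true} () _

-- Elements of a Boolean-predicated Σ-type are determined by their first
-- component (the proof component is a proof of T, hence irrelevant).
Σ-≡ : ∀ {A : Set} {P : A → Bool} {x y : A} {p : T (P x)} {q : T (P y)} →
      x ≡ y → _≡_ {A = Σ A (T ∘ P)} (x , p) (y , q)
Σ-≡ {p = p} {q} refl = cong (_ ,_) (T-irr p q)

any-witness : ∀ {A : Set} (p : A → Bool) xs → T (any p xs) → Σ A (T ∘ p)
any-witness p xs h = satisfied (any⁻ p xs h)

any-intro : ∀ {A : Set} (p : A → Bool) {xs x} → x ∈ xs → T (p x) → T (any p xs)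
any-intro p m q = any⁺ p (lose m q)

module _ {S : Sig} where

  Edge : (G : TGraph S) → V G → V G → Set
  Edge G x y = Σ (E G) λ e → src G e ≡ x × tgt G e ≡ y

  NonBang : (G : TGraph S) → V G → Set
  NonBang G v = T (not (isBangV G v))

  IsInput IsOutput : (G : TGraph S) → V G → Set
  IsInput G v = T (isWireV G v) × (∀ e → tgt G e ≡ v → T (isBangV G (src G e)))
  IsOutput G v = T (isWireV G v) × (∀ e → src G e ≡ v → T (isBangV G (tgt G e)))

  module _ (G : TGraph S) where
    ≟-sound : ∀ {x y} → T ⌊ decV G x y ⌋ → x ≡ y
    ≟-sound {x} {y} = toWitness {a? = decV G x y}

    ≟-complete : ∀ {x y} → x ≡ y → T ⌊ decV G x y ⌋
    ≟-complete {x} {y} = fromWitness {a? = decV G x y}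

    private
      edgeTest : V G → V G → E G → Bool
      edgeTest b v e = ⌊ decV G (src G e) b ⌋ ∧ ⌊ decV G (tgt G e) v ⌋

      innerInTest innerOutTest : V G → E G → Bool
      innerInTest v e = ⌊ decV G (tgt G e) v ⌋ ∧ not (isBangV G (src G e))
      innerOutTest v e = ⌊ decV G (src G e) v ⌋ ∧ not (isBangV G (tgt G e))

    inB⇒Edge : ∀ {b v} → T (inB G b v) → Edge G b v
    inB⇒Edge {b} {v} h =
      let (e , q) = any-witness (edgeTest b v) (enumE G) h in
      e , ≟-sound (∧-fst q) , ≟-sound (∧-snd q)

    Edge⇒inB : ∀ {b v} → Edge G b v → T (inB G b v)
    Edge⇒inB {b} {v} (e , s , t) =
      any-intro (edgeTest b v) (enumE-complete G e) (∧-intro (≟-complete s) (≟-complete t))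

    isInput⇒IsInput : ∀ {v} → T (isInput G v) → IsInput G v
    isInput⇒IsInput {v} h = ∧-fst h , fromBang
      where
      fromBang : ∀ e → tgt G e ≡ v → T (isBangV G (src G e))
      fromBang e t with T? (isBangV G (src G e))
      ... | yes bang = bang
      ... | no nonBang = ⊥-elim (not-elim (∧-snd h)
              (any-intro (innerInTest v) (enumE-complete G e) (∧-intro (≟-complete t) (not-intro nonBang))))

    IsInput⇒isInput : ∀ {v} → IsInput G v → T (isInput G v)
    IsInput⇒isInput {v} (wire , fromBang) = ∧-intro wire (not-intro λ h →
      let (e , q) = any-witness (innerInTest v) (enumE G) h in
      not-elim (∧-snd q) (fromBang e (≟-sound (∧-fst q))))

    isOutput⇒IsOutput : ∀ {v} → T (isOutput G v) → IsOutput G v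
    isOutput⇒IsOutput {v} h = ∧-fst h , toBang
      where
      toBang : ∀ e → src G e ≡ v → T (isBangV G (tgt G e))
      toBang e s with T? (isBangV G (tgt G e))
      ... | yes bang = bang
      ... | no nonBang = ⊥-elim (not-elim (∧-snd h)
              (any-intro (innerOutTest v) (enumE-complete G e) (∧-intro (≟-complete s) (not-intro nonBang))))

    IsOutput⇒isOutput : ∀ {v} → IsOutput G v → T (isOutput G v)
    IsOutput⇒isOutput {v} (wire , toBang) = ∧-intro wire (not-intro λ h →
      let (e , q) = any-witness (innerOutTest v) (enumE G) h in
      not-elim (∧-snd q) (toBang e (≟-sound (∧-fst q))))

-- The string-graph conditions, restricted to the vertices satisfying a
-- predicate P (and to the edges between such vertices).  U(G), open
-- subgraphs of U(G) and their images all instantiate this notion, and it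
-- is preserved by the constructions below.

module _ {S : Sig} where

  record StringOn (G : TGraph S) (P : V G → Set) : Set where
    field
      str-noBang : ∀ v → P v → ¬ T (isBangV G v)
      str-nodeInj : ∀ n → P n → T (isNodeV G n) → ∀ e e' →
        P (src G e) → P (tgt G e) → P (src G e') → P (tgt G e') →
        IsFixed G e → IsFixed G e' → Incident G n e → Incident G n e' → tyE G e ≡ tyE G e' → e ≡ e'
      str-nodeSurj : ∀ n → P n → T (isNodeV G n) → ∀ t → T (isFixedT S t) →
        (srcT S t ≡ tyV G n ⊎ tgtT S t ≡ tyV G n) →
        Σ (E G) λ e → P (src G e) × P (tgt G e) × Incident G n e × tyE G e ≡ t
      str-wireIn : ∀ w → P w → T (isWireV G w) → ∀ e e' → P (src G e) → P (src G e') →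
        tgt G e ≡ w → tgt G e' ≡ w → e ≡ e'
      str-wireOut : ∀ w → P w → T (isWireV G w) → ∀ e e' → P (tgt G e) → P (tgt G e') →
        src G e ≡ w → src G e' ≡ w → e ≡ e'
  open StringOn public

  stringOn-⇔ : ∀ (G : TGraph S) {P P' : V G → Set} → (∀ v → P' v → P v) → (∀ v → P v → P' v) →
    StringOn G P → StringOn G P'
  stringOn-⇔ G f g s = record
    { str-noBang = λ v p → str-noBang s v (f v p)
    ; str-nodeInj = λ n p nd e e' a b c d → str-nodeInj s n (f _ p) nd e e' (f _ a) (f _ b) (f _ c) (f _ d)
    ; str-nodeSurj = λ n p nd t ft st → let (e , a , b , r) = str-nodeSurj s n (f _ p) nd t ft st in e , g _ a , g _ b , r
    ; str-wireIn = λ w p wi e e' a b → str-wireIn s w (f _ p) wi e e' (f _ a) (f _ b)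
    ; str-wireOut = λ w p wi e e' a b → str-wireOut s w (f _ p) wi e e' (f _ a) (f _ b)
    }

  module _ (G : TGraph S) (Pb : V G → Bool) where
    private
      F = Full G Pb

    incidentDown : ∀ {n p e q} → Incident F (n , p) (e , q) → Incident G n e
    incidentDown (inj₁ x) = inj₁ (cong proj₁ x)
    incidentDown (inj₂ x) = inj₂ (cong proj₁ x)

    incidentUp : ∀ {n p e q} → Incident G n e → Incident F (n , p) (e , q)
    incidentUp (inj₁ x) = inj₁ (Σ-≡ x)
    incidentUp (inj₂ x) = inj₂ (Σ-≡ x)

    stringOn-toFull : (Q : V G → Set) → StringOn G (λ v → T (Pb v) × Q v) → StringOn F (Q ∘ proj₁)
    stringOn-toFull Q s = record
      { str-noBang = λ { (v , p) q → str-noBang s v (p , q) }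
      ; str-nodeInj = λ { (n , p) q nd (e , r) (e' , r') a b c d fx fx' i i' ty →
          Σ-≡ (str-nodeInj s n (p , q) nd e e' (∧-fst r , a) (∧-snd r , b) (∧-fst r' , c) (∧-snd r' , d)
                 fx fx' (incidentDown i) (incidentDown i') ty) }
      ; str-nodeSurj = λ { (n , p) q nd t ft st →
          let (e , (a₁ , a₂) , (b₁ , b₂) , i , ty) = str-nodeSurj s n (p , q) nd t ft st in
          (e , ∧-intro a₁ b₁) , a₂ , b₂ , incidentUp i , ty }
      ; str-wireIn = λ { (w , p) q wi (e , r) (e' , r') a b t t' →
          Σ-≡ (str-wireIn s w (p , q) wi e e' (∧-fst r , a) (∧-fst r' , b) (cong proj₁ t) (cong proj₁ t')) }
      ; str-wireOut = λ { (w , p) q wi (e , r) (e' , r') a b t t' →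
          Σ-≡ (str-wireOut s w (p , q) wi e e' (∧-snd r , a) (∧-snd r' , b) (cong proj₁ t) (cong proj₁ t')) }
      }

    stringOn-fromFull : (Q : V G → Set) → StringOn F (Q ∘ proj₁) → StringOn G (λ v → T (Pb v) × Q v)
    stringOn-fromFull Q s = record
      { str-noBang = λ v (p , q) → str-noBang s (v , p) q
      ; str-nodeInj = λ n (p , q) nd e e' a b c d fx fx' i i' ty →
          cong proj₁ (str-nodeInj s (n , p) q nd (e , ∧-intro (proj₁ a) (proj₁ b)) (e' , ∧-intro (proj₁ c) (proj₁ d))
            (proj₂ a) (proj₂ b) (proj₂ c) (proj₂ d) fx fx' (incidentUp i) (incidentUp i') ty)
      ; str-nodeSurj = λ n (p , q) nd t ft st →
          let ((e , r) , a , b , i , ty) = str-nodeSurj s (n , p) q nd t ft st in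
          e , (∧-fst r , a) , (∧-snd r , b) , incidentDown i , ty
      ; str-wireIn = λ w (p , q) wi e e' a b t t' →
          cong proj₁ (str-wireIn s (w , p) q wi (e , ∧-intro (proj₁ a) (subst (T ∘ Pb) (sym t) p))
            (e' , ∧-intro (proj₁ b) (subst (T ∘ Pb) (sym t') p)) (proj₂ a) (proj₂ b) (Σ-≡ t) (Σ-≡ t'))
      ; str-wireOut = λ w (p , q) wi e e' a b t t' →
          cong proj₁ (str-wireOut s (w , p) q wi (e , ∧-intro (subst (T ∘ Pb) (sym t) p) (proj₁ a))
            (e' , ∧-intro (subst (T ∘ Pb) (sym t') p) (proj₁ b)) (proj₂ a) (proj₂ b) (Σ-≡ t) (Σ-≡ t'))
      }

  stringOn⇒string : (G : TGraph S) → StringOn G (λ _ → ⊤) → IsStringGraph G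
  stringOn⇒string G s =
    (λ v → str-noBang s v tt) ,
    (λ n nd → (λ e e' → str-nodeInj s n tt nd e e' tt tt tt tt) ,
              (λ t ft st → let (e , _ , _ , i , ty) = str-nodeSurj s n tt nd t ft st in e , i , ty)) ,
    (λ w wi → (λ e e' → str-wireIn s w tt wi e e' tt tt) , (λ e e' → str-wireOut s w tt wi e e' tt tt))

  string⇒stringOn : (G : TGraph S) → IsStringGraph G → StringOn G (λ _ → ⊤)
  string⇒stringOn G (noBang , nodes , wires) = record
    { str-noBang = λ v _ → noBang v
    ; str-nodeInj = λ n _ nd e e' _ _ _ _ → proj₁ (nodes n nd) e e'
    ; str-nodeSurj = λ n _ nd t ft st → let (e , i , ty) = proj₂ (nodes n nd) t ft st in e , tt , tt , i , ty
    ; str-wireIn = λ w _ wi e e' _ _ → proj₁ (wires w wi) e e'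
    ; str-wireOut = λ w _ wi e e' _ _ → proj₂ (wires w wi) e e'
    }

  stringOn-shrink : (G : TGraph S) {P P' : V G → Set} → StringOn G P → (∀ v → P' v → P v) →
    (∀ n e → P' n → T (isNodeV G n) → IsFixed G e → Incident G n e →
       P (src G e) → P (tgt G e) → P' (src G e) × P' (tgt G e)) →
    StringOn G P'
  stringOn-shrink G s f closed = record
    { str-noBang = λ v p → str-noBang s v (f v p)
    ; str-nodeInj = λ n p nd e e' a b c d → str-nodeInj s n (f _ p) nd e e' (f _ a) (f _ b) (f _ c) (f _ d)
    ; str-nodeSurj = λ n p nd t ft st →
        let (e , a , b , i , ty) = str-nodeSurj s n (f _ p) nd t ft st
            (a' , b') = closed n e p nd (subst (T ∘ isFixedT S) (sym ty) ft) i a b in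
        e , a' , b' , i , ty
    ; str-wireIn = λ w p wi e e' a b → str-wireIn s w (f _ p) wi e e' (f _ a) (f _ b)
    ; str-wireOut = λ w p wi e e' a b → str-wireOut s w (f _ p) wi e e' (f _ a) (f _ b)
    }

  module _ {G H : TGraph S} (h : Hom G H) where
    bang-pres : ∀ v → isBangV H (fV h v) ≡ isBangV G v
    bang-pres v = cong isBangT (tyV-comm h v)

    wire-pres : ∀ v → isWireV H (fV h v) ≡ isWireV G v
    wire-pres v = cong isWireT (tyV-comm h v)

    node-pres : ∀ v → isNodeV H (fV h v) ≡ isNodeV G v
    node-pres v = cong isNodeT (tyV-comm h v)

    fixed-pres : ∀ e → IsFixed H (fE h e) ≡ IsFixed G e
    fixed-pres e = cong (T ∘ isFixedT S) (tyE-comm h e)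

    edge-pres : ∀ {x y} → Edge G x y → Edge H (fV h x) (fV h y)
    edge-pres (e , s , t) = fE h e , trans (src-comm h e) (cong (fV h) s) , trans (tgt-comm h e) (cong (fV h) t)

    incident-pres : ∀ {n e} → Incident G n e → Incident H (fV h n) (fE h e)
    incident-pres (inj₁ x) = inj₁ (trans (src-comm h _) (cong (fV h) x))
    incident-pres (inj₂ x) = inj₂ (trans (tgt-comm h _) (cong (fV h) x))

    stringOn-pullback : (P : V G → Set) (P' : V H → Set) → (∀ v → P v → P' (fV h v)) → StringOn H P' →
      (∀ n → P n → T (isNodeV G n) → ∀ e e' → P (src G e) → P (tgt G e) → P (src G e') → P (tgt G e') →
         IsFixed G e → IsFixed G e' → Incident G n e → Incident G n e' → fE h e ≡ fE h e' → e ≡ e') →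
      (∀ w → P w → T (isWireV G w) → ∀ e e' → P (src G e) → P (src G e') →
         tgt G e ≡ w → tgt G e' ≡ w → fE h e ≡ fE h e' → e ≡ e') →
      (∀ w → P w → T (isWireV G w) → ∀ e e' → P (tgt G e) → P (tgt G e') →
         src G e ≡ w → src G e' ≡ w → fE h e ≡ fE h e' → e ≡ e') →
      (∀ n → P n → T (isNodeV G n) → ∀ e' → IsFixed H e' → P' (src H e') → P' (tgt H e') → Incident H (fV h n) e' →
         Σ (E G) λ e → P (src G e) × P (tgt G e) × Incident G n e × tyE G e ≡ tyE H e') →
      StringOn G P
    stringOn-pullback P P' maps s nodeInj wireInInj wireOutInj liftFixed = record
      { str-noBang = λ v p b → str-noBang s (fV h v) (maps v p) (subst T (sym (bang-pres v)) b)
      ; str-nodeInj = λ n p nd e e' a b c d fx fx' i i' ty →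
          nodeInj n p nd e e' a b c d fx fx' i i'
            (str-nodeInj s (fV h n) (maps n p) (subst T (sym (node-pres n)) nd) (fE h e) (fE h e')
              (atSrc e a) (atTgt e b) (atSrc e' c) (atTgt e' d)
              (subst id (sym (fixed-pres e)) fx) (subst id (sym (fixed-pres e')) fx')
              (incident-pres i) (incident-pres i')
              (trans (tyE-comm h e) (trans ty (sym (tyE-comm h e')))))
      ; str-nodeSurj = λ n p nd t ft st →
          let st' = ⊎-map (λ z → trans z (sym (tyV-comm h n))) (λ z → trans z (sym (tyV-comm h n))) st
              (e' , a , b , i , ty) = str-nodeSurj s (fV h n) (maps n p) (subst T (sym (node-pres n)) nd) t ft st'
              (e , a₂ , b₂ , i₂ , ty₂) = liftFixed n p nd e' (subst (T ∘ isFixedT S) (sym ty) ft) a b i in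
          e , a₂ , b₂ , i₂ , trans ty₂ ty
      ; str-wireIn = λ w p wi e e' a b t t' → wireInInj w p wi e e' a b t t'
          (str-wireIn s (fV h w) (maps w p) (subst T (sym (wire-pres w)) wi) (fE h e) (fE h e') (atSrc e a) (atSrc e' b)
             (trans (tgt-comm h e) (cong (fV h) t)) (trans (tgt-comm h e') (cong (fV h) t')))
      ; str-wireOut = λ w p wi e e' a b t t' → wireOutInj w p wi e e' a b t t'
          (str-wireOut s (fV h w) (maps w p) (subst T (sym (wire-pres w)) wi) (fE h e) (fE h e') (atTgt e a) (atTgt e' b)
             (trans (src-comm h e) (cong (fV h) t)) (trans (src-comm h e') (cong (fV h) t')))
      }
      where
      atSrc : ∀ e → P (src G e) → P' (src H (fE h e))
      atSrc e a = subst P' (sym (src-comm h e)) (maps _ a)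
      atTgt : ∀ e → P (tgt G e) → P' (tgt H (fE h e))
      atTgt e a = subst P' (sym (tgt-comm h e)) (maps _ a)

module _ {S : Sig} where

  record BangPoset (G : TGraph S) : Set where
    field
      po-unique : ∀ e e' → T (isBangV G (src G e)) → T (isBangV G (tgt G e)) →
        src G e ≡ src G e' → tgt G e ≡ tgt G e' → e ≡ e'
      po-refl : ∀ v → T (isBangV G v) → Edge G v v
      po-trans : ∀ x y z → T (isBangV G x) → T (isBangV G y) → T (isBangV G z) →
        Edge G x y → Edge G y z → Edge G x z
      po-antisym : ∀ x y → T (isBangV G x) → T (isBangV G y) → Edge G x y → Edge G y x → x ≡ y
  open BangPoset public

  record OpenBox (G : TGraph S) (b : V G) : Set where
    field
      box-string : StringOn G (λ v → NonBang G v × Edge G b v)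
      box-noWireOut : ∀ e → NonBang G (src G e) → NonBang G (tgt G e) →
        Edge G b (src G e) → ¬ Edge G b (tgt G e) → T (isWireV G (tgt G e)) → ⊥
      box-noWireIn : ∀ e → NonBang G (src G e) → NonBang G (tgt G e) →
        Edge G b (tgt G e) → ¬ Edge G b (src G e) → T (isWireV G (src G e)) → ⊥
      box-fixed : ∀ e → NonBang G (src G e) → NonBang G (tgt G e) → IsFixed G e →
        Edge G b (src G e) ⊎ Edge G b (tgt G e) → Edge G b (src G e) × Edge G b (tgt G e)
  open OpenBox public

  record BangGraph (G : TGraph S) : Set where
    field
      bang-string : StringOn G (NonBang G)
      bang-poset : BangPoset G
      bang-open : ∀ b → T (isBangV G b) → OpenBox G b
      bang-nested : ∀ b b' → T (isBangV G b) → T (isBangV G b') → Edge G b b' →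
        ∀ v → Edge G b' v → Edge G b v
  open BangGraph public

  WiresIncident : TGraph S → Set
  WiresIncident G = ∀ w → NonBang G w → T (isWireV G w) →
    Σ (E G) λ e → NonBang G (src G e) × NonBang G (tgt G e) × Incident G w e

  module _ (G : TGraph S) where
    private
      isBang = isBangV G
      nonBang = λ v → not (isBangV G v)

    poset⇒posetal : BangPoset G → IsPosetal (β G)
    poset⇒posetal p =
      (λ { (e , q) (e' , q') s t → Σ-≡ (po-unique p e e' (∧-fst q) (∧-snd q) (cong proj₁ s) (cong proj₁ t)) }) ,
      (λ { (v , pv) → let (e , s , t) = po-refl p v pv in
           (e , ∧-intro (subst (T ∘ isBang) (sym s) pv) (subst (T ∘ isBang) (sym t) pv)) , Σ-≡ s , Σ-≡ t }) ,
      (λ { (e , q) (e' , q') m →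
           let (d , s , t) = po-trans p (src G e) (tgt G e) (tgt G e') (∧-fst q) (∧-snd q) (∧-snd q')
                               (e , refl , refl) (e' , sym (cong proj₁ m) , refl) in
           (d , ∧-intro (subst (T ∘ isBang) (sym s) (∧-fst q)) (subst (T ∘ isBang) (sym t) (∧-snd q'))) ,
           Σ-≡ s , Σ-≡ t }) ,
      (λ { (e , q) (e' , q') m₁ m₂ →
           Σ-≡ (po-antisym p (src G e) (tgt G e) (∧-fst q) (∧-snd q)
                  (e , refl , refl) (e' , sym (cong proj₁ m₂) , sym (cong proj₁ m₁))) })

    posetal⇒poset : IsPosetal (β G) → BangPoset G
    posetal⇒poset (unique , refl' , trans' , antisym) = record
      { po-unique = λ e e' bs bt s t → cong proj₁ (unique (e , ∧-intro bs bt)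
            (e' , ∧-intro (subst (T ∘ isBang) s bs) (subst (T ∘ isBang) t bt)) (Σ-≡ s) (Σ-≡ t))
      ; po-refl = λ v pv → let ((e , _) , s , t) = refl' (v , pv) in e , cong proj₁ s , cong proj₁ t
      ; po-trans = λ { x y z bx by bz (e , refl , refl) (e' , s' , refl) →
            let ((d , _) , s'' , t'') = trans' (e , ∧-intro bx by)
                  (e' , ∧-intro (subst (T ∘ isBang) (sym s') by) bz) (Σ-≡ (sym s')) in
            d , cong proj₁ s'' , cong proj₁ t'' }
      ; po-antisym = λ { x y bx by (e , refl , refl) (e' , s' , t') →
            cong proj₁ (antisym (e , ∧-intro bx by)
              (e' , ∧-intro (subst (T ∘ isBang) (sym s') by) (subst (T ∘ isBang) (sym t') bx))
              (Σ-≡ (sym t')) (Σ-≡ (sym s'))) }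
      }

    private
      inBox : (b : V G) → V (U G) → Bool
      inBox b x = inB G b (proj₁ x)

    openBox⇒open : ∀ b → OpenBox G b → IsOpenFull (U G) (inBox b)
    openBox⇒open b o =
      stringOn⇒string (Full (U G) (inBox b)) (stringOn-toFull (U G) (inBox b) (λ _ → ⊤)
        (stringOn-toFull G nonBang (λ v → T (inB G b v) × ⊤)
          (stringOn-⇔ G (λ v (nb , ib , _) → nb , inB⇒Edge G ib) (λ v (nb , eb) → nb , Edge⇒inB G eb , tt)
            (box-string o)))) ,
      (λ { (_ , _) (_ , _) (e , q) p np wi (inj₁ (refl , refl)) →
             box-noWireOut o e (∧-fst q) (∧-snd q) (inB⇒Edge G p) (np ∘ Edge⇒inB G) wi
         ; (_ , _) (_ , _) (e , q) p np wi (inj₂ (refl , refl)) →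
             box-noWireIn o e (∧-fst q) (∧-snd q) (inB⇒Edge G p) (np ∘ Edge⇒inB G) wi }) ,
      (λ { (e , q) fx ends →
             let (s , t) = box-fixed o e (∧-fst q) (∧-snd q) fx (⊎-map (inB⇒Edge G) (inB⇒Edge G) ends) in
             Edge⇒inB G s , Edge⇒inB G t })

    open⇒openBox : ∀ b → IsOpenFull (U G) (inBox b) → OpenBox G b
    open⇒openBox b (str , noWire , fixed) = record
      { box-string = stringOn-⇔ G (λ v (nb , eb) → nb , Edge⇒inB G eb , tt) (λ v (nb , ib , _) → nb , inB⇒Edge G ib)
          (stringOn-fromFull G nonBang (λ v → T (inB G b v) × ⊤)
            (stringOn-fromFull (U G) (inBox b) (λ _ → ⊤) (string⇒stringOn (Full (U G) (inBox b)) str)))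
      ; box-noWireOut = λ e ns nt eb neb wi → noWire (src G e , ns) (tgt G e , nt) (e , ∧-intro ns nt)
          (Edge⇒inB G eb) (neb ∘ inB⇒Edge G) wi (inj₁ (Σ-≡ refl , Σ-≡ refl))
      ; box-noWireIn = λ e ns nt eb neb wi → noWire (tgt G e , nt) (src G e , ns) (e , ∧-intro ns nt)
          (Edge⇒inB G eb) (neb ∘ inB⇒Edge G) wi (inj₂ (Σ-≡ refl , Σ-≡ refl))
      ; box-fixed = λ e ns nt fx ends →
          let (s , t) = fixed (e , ∧-intro ns nt) fx (⊎-map (Edge⇒inB G) (Edge⇒inB G) ends) in
          inB⇒Edge G s , inB⇒Edge G t
      }

    bangGraph⇒isBGraph : BangGraph G → IsBGraph G
    bangGraph⇒isBGraph g =
      stringOn⇒string (U G) (stringOn-toFull G nonBang (λ _ → ⊤)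
        (stringOn-⇔ G (λ v → proj₁) (λ v nb → nb , tt) (bang-string g))) ,
      poset⇒posetal (bang-poset g) ,
      (λ b pb → openBox⇒open b (bang-open g b pb)) ,
      (λ b b' pb pb' i v i' → Edge⇒inB G (bang-nested g b b' pb pb' (inB⇒Edge G i) v (inB⇒Edge G i')))

    isBGraph⇒bangGraph : IsBGraph G → BangGraph G
    isBGraph⇒bangGraph (str , poset , open' , nested) = record
      { bang-string = stringOn-⇔ G (λ v nb → nb , tt) (λ v → proj₁)
          (stringOn-fromFull G nonBang (λ _ → ⊤) (string⇒stringOn (U G) str))
      ; bang-poset = posetal⇒poset poset
      ; bang-open = λ b pb → open⇒openBox b (open' b pb)
      ; bang-nested = λ b b' pb pb' i v i' → inB⇒Edge G (nested b b' pb pb' (Edge⇒inB G i) v (Edge⇒inB G i'))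
      }

    wiresIncident⇒noIsolated : WiresIncident G → NoIsolatedWires (U G)
    wiresIncident⇒noIsolated n (w , p) wi =
      let (e , a , c , i) = n w p wi in (e , ∧-intro a c) , incidentUp G nonBang i

    noIsolated⇒wiresIncident : NoIsolatedWires (U G) → WiresIncident G
    noIsolated⇒wiresIncident n w p wi =
      let ((e , q) , i) = n (w , p) wi in e , ∧-fst q , ∧-snd q , incidentDown G nonBang i

module _ {S : Sig} where

  Boundary InBoundary OutBoundary : (G : TGraph S) → V G → Set
  Boundary G v = T (isBangV G v) ⊎ IsInput G v ⊎ IsOutput G v
  InBoundary G v = T (isBangV G v) ⊎ IsInput G v
  OutBoundary G v = T (isBangV G v) ⊎ IsOutput G v

  module _ (G : TGraph S) where
    boundP⇒Boundary : ∀ {v} → T (boundP G v) → Boundary G v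
    boundP⇒Boundary p with ∨-cases p
    ... | inj₁ b = inj₁ b
    ... | inj₂ r with ∨-cases r
    ... | inj₁ i = inj₂ (inj₁ (isInput⇒IsInput G i))
    ... | inj₂ o = inj₂ (inj₂ (isOutput⇒IsOutput G o))

    Boundary⇒boundP : ∀ {v} → Boundary G v → T (boundP G v)
    Boundary⇒boundP (inj₁ b) = ∨-inl b
    Boundary⇒boundP {v} (inj₂ (inj₁ i)) = ∨-inr {isBangV G v} (∨-inl (IsInput⇒isInput G i))
    Boundary⇒boundP {v} (inj₂ (inj₂ o)) = ∨-inr {isBangV G v} (∨-inr {isInput G v} (IsOutput⇒isOutput G o))

    inP⇒InBoundary : ∀ {v} → T (inP G v) → InBoundary G v
    inP⇒InBoundary p = ⊎-map id (isInput⇒IsInput G) (∨-cases p)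

    InBoundary⇒inP : ∀ {v} → InBoundary G v → T (inP G v)
    InBoundary⇒inP (inj₁ b) = ∨-inl b
    InBoundary⇒inP {v} (inj₂ i) = ∨-inr {isBangV G v} (IsInput⇒isInput G i)

    outP⇒OutBoundary : ∀ {v} → T (outP G v) → OutBoundary G v
    outP⇒OutBoundary p = ⊎-map id (isOutput⇒IsOutput G) (∨-cases p)

    OutBoundary⇒outP : ∀ {v} → OutBoundary G v → T (outP G v)
    OutBoundary⇒outP (inj₁ b) = ∨-inl b
    OutBoundary⇒outP {v} (inj₂ o) = ∨-inr {isBangV G v} (IsOutput⇒isOutput G o)

    in⊆boundary : ∀ {v} → InBoundary G v → Boundary G v
    in⊆boundary = ⊎-map id inj₁

    out⊆boundary : ∀ {v} → OutBoundary G v → Boundary G v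
    out⊆boundary = ⊎-map id inj₂

    -- in 𝒢_{T!} the only edge into ! is the loop on !
    into-bang : ∀ e → T (isBangV G (tgt G e)) → T (isBangV G (src G e))
    into-bang e p = subst (T ∘ isBangT) (src-ty G e) (typegraph (tyE G e) (subst (T ∘ isBangT) (sym (tgt-ty G e)) p))
      where
      typegraph : ∀ (t : TE S) → T (isBangT (tgtT S t)) → T (isBangT (srcT S t))
      typegraph bangLoopT _ = tt

    -- edges of In_!(G) and of Out_!(G) start at !-vertices, hence are edges of Bound_!(G)
    inEdge-bang : ∀ e → T (inP G (src G e)) → T (inP G (tgt G e)) → T (isBangV G (src G e))
    inEdge-bang e _ pt with inP⇒InBoundary pt
    ... | inj₁ b = into-bang e b
    ... | inj₂ (_ , fromBang) = fromBang e refl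

    outEdge-bang : ∀ e → T (outP G (src G e)) → T (outP G (tgt G e)) → T (isBangV G (src G e))
    outEdge-bang e ps _ with outP⇒OutBoundary ps
    ... | inj₁ b = b
    ... | inj₂ (_ , toBang) = into-bang e (toBang e refl)

    intoBound : (Q : V G → Bool) → (∀ {v} → T (Q v) → Boundary G v) →
      (∀ e → T (Q (src G e)) → T (Q (tgt G e)) → T (isBangV G (src G e))) →
      Hom (Sub G Q (allE G)) (Bound! G)
    intoBound Q inBoundary edgeBang = record
      { fV = λ (v , p) → v , Boundary⇒boundP (inBoundary p)
      ; fE = λ (e , q) → e , ∧-intro (edgeBang e (∧-fst q) (∧-snd q))
          (∧-intro (Boundary⇒boundP (inBoundary (∧-fst q))) (Boundary⇒boundP (inBoundary (∧-snd q))))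
      ; src-comm = λ _ → Σ-≡ refl
      ; tgt-comm = λ _ → Σ-≡ refl
      ; tyV-comm = λ _ → refl
      ; tyE-comm = λ _ → refl
      }

  record BoundaryEmbedding {I G : TGraph S} (i : Hom I G) : Set where
    field
      emb-injV : ∀ x y → fV i x ≡ fV i y → x ≡ y
      emb-injE : ∀ x y → fE i x ≡ fE i y → x ≡ y
      emb-boundaryV : ∀ x → Boundary G (fV i x)
      emb-preimageV : ∀ v → Boundary G v → Σ (V I) λ x → fV i x ≡ v
      emb-bangE : ∀ x → T (isBangV G (src G (fE i x)))
      emb-preimageE : ∀ e → T (isBangV G (src G e)) → Boundary G (tgt G e) → Σ (E I) λ x → fE i x ≡ e
  open BoundaryEmbedding public

  record EquationChar {L I R : TGraph S} (i₁ : Hom I L) (i₂ : Hom I R) : Set where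
    field
      ch-L : BangGraph L
      ch-I : BangGraph I
      ch-R : BangGraph R
      ch-Lwires : WiresIncident L
      ch-Rwires : WiresIncident R
      ch-emb₁ : BoundaryEmbedding i₁
      ch-emb₂ : BoundaryEmbedding i₂
      ch-in→ : ∀ x → InBoundary L (fV i₁ x) → InBoundary R (fV i₂ x)
      ch-in← : ∀ x → InBoundary R (fV i₂ x) → InBoundary L (fV i₁ x)
      ch-out→ : ∀ x → OutBoundary L (fV i₁ x) → OutBoundary R (fV i₂ x)
      ch-out← : ∀ x → OutBoundary R (fV i₂ x) → OutBoundary L (fV i₁ x)
  open EquationChar public

-- From the characterisation back to IsEquation: the isomorphisms
-- required by IsEquation are obtained by inverting boundary embeddings.

module _ {S : Sig} where

  module BoundaryIso {I G : TGraph S} (i : Hom I G) (emb : BoundaryEmbedding i) where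
    private
      tgtBoundary : (y : E (Bound! G)) → Boundary G (tgt G (proj₁ y))
      tgtBoundary (e , q) = boundP⇒Boundary G (∧-snd {boundP G (src G e)} (∧-snd {isBangV G (src G e)} q))

    preV : V (Bound! G) → V I
    preV (v , p) = proj₁ (emb-preimageV emb v (boundP⇒Boundary G p))

    preV-spec : ∀ y → fV i (preV y) ≡ proj₁ y
    preV-spec (v , p) = proj₂ (emb-preimageV emb v (boundP⇒Boundary G p))

    preE : E (Bound! G) → E I
    preE (e , q) = proj₁ (emb-preimageE emb e (∧-fst q) (tgtBoundary (e , q)))

    preE-spec : ∀ y → fE i (preE y) ≡ proj₁ y
    preE-spec (e , q) = proj₂ (emb-preimageE emb e (∧-fst q) (tgtBoundary (e , q)))

    toI : Hom (Bound! G) I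
    toI = record
      { fV = preV ; fE = preE
      ; src-comm = λ y → emb-injV emb _ _ (src-commutes y)
      ; tgt-comm = λ y → emb-injV emb _ _ (tgt-commutes y)
      ; tyV-comm = λ y → trans (sym (tyV-comm i (preV y))) (cong (tyV G) (preV-spec y))
      ; tyE-comm = λ y → trans (sym (tyE-comm i (preE y))) (cong (tyE G) (preE-spec y))
      }
      where
      src-commutes : ∀ y → fV i (src I (preE y)) ≡ fV i (preV (src (Bound! G) y))
      src-commutes y = trans (sym (src-comm i (preE y))) (trans (cong (src G) (preE-spec y)) (sym (preV-spec (src (Bound! G) y))))
      tgt-commutes : ∀ y → fV i (tgt I (preE y)) ≡ fV i (preV (tgt (Bound! G) y))
      tgt-commutes y = trans (sym (tgt-comm i (preE y))) (trans (cong (tgt G) (preE-spec y)) (sym (preV-spec (tgt (Bound! G) y))))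

    fromI : Hom I (Bound! G)
    fromI = record
      { fV = λ x → fV i x , Boundary⇒boundP G (emb-boundaryV emb x)
      ; fE = λ x → fE i x , ∧-intro (emb-bangE emb x) (∧-intro (endBound (src-comm i x)) (endBound (tgt-comm i x)))
      ; src-comm = λ x → Σ-≡ (src-comm i x)
      ; tgt-comm = λ x → Σ-≡ (tgt-comm i x)
      ; tyV-comm = tyV-comm i
      ; tyE-comm = tyE-comm i
      }
      where
      endBound : ∀ {v x} → v ≡ fV i x → T (boundP G v)
      endBound {x = x} eq = subst (T ∘ boundP G) (sym eq) (Boundary⇒boundP G (emb-boundaryV emb x))

    boundaryIso : Iso (Bound! G) I
    boundaryIso = record
      { to = toI ; from = fromI
      ; from-to-V = λ y → Σ-≡ (preV-spec y)
      ; from-to-E = λ y → Σ-≡ (preE-spec y)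
      ; to-from-V = λ x → emb-injV emb _ _ (preV-spec (fV fromI x))
      ; to-from-E = λ x → emb-injE emb _ _ (preE-spec (fE fromI x))
      }

  module Transfer {I L R : TGraph S} (i₁ : Hom I L) (i₂ : Hom I R) (emb₁ : BoundaryEmbedding i₁)
    (QL : V L → Bool) (QR : V R → Bool)
    (QL-boundary : ∀ {v} → T (QL v) → Boundary L v)
    (QL-edgeBang : ∀ e → T (QL (src L e)) → T (QL (tgt L e)) → T (isBangV L (src L e)))
    (corresp : ∀ x → T (QL (fV i₁ x)) → T (QR (fV i₂ x))) where

    j : Hom (Sub L QL (allE L)) I
    j = BoundaryIso.toI i₁ emb₁ ∘H intoBound L QL QL-boundary QL-edgeBang

    i₁∘jV : ∀ y → fV i₁ (fV j y) ≡ proj₁ y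
    i₁∘jV (v , p) = BoundaryIso.preV-spec i₁ emb₁ (v , Boundary⇒boundP L (QL-boundary p))

    i₁∘jE : ∀ y → fE i₁ (fE j y) ≡ proj₁ y
    i₁∘jE y = BoundaryIso.preE-spec i₁ emb₁ (fE (intoBound L QL QL-boundary QL-edgeBang) y)

    j∘i₁V : ∀ x p → fV j (fV i₁ x , p) ≡ x
    j∘i₁V x p = emb-injV emb₁ _ _ (i₁∘jV (fV i₁ x , p))

    j∘i₁E : ∀ x p → fE j (fE i₁ x , p) ≡ x
    j∘i₁E x p = emb-injE emb₁ _ _ (i₁∘jE (fE i₁ x , p))

    private
      inQR : ∀ y → T (QR (fV i₂ (fV j y)))
      inQR (v , p) = corresp _ (subst (T ∘ QL) (sym (i₁∘jV (v , p))) p)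

      src≡ : ∀ y → src R (fE i₂ (fE j y)) ≡ fV i₂ (fV j (src (Sub L QL (allE L)) y))
      src≡ y = trans (src-comm i₂ _) (cong (fV i₂) (src-comm j y))

      tgt≡ : ∀ y → tgt R (fE i₂ (fE j y)) ≡ fV i₂ (fV j (tgt (Sub L QL (allE L)) y))
      tgt≡ y = trans (tgt-comm i₂ _) (cong (fV i₂) (tgt-comm j y))

    transfer : Hom (Sub L QL (allE L)) (Sub R QR (allE R))
    transfer = record
      { fV = λ y → fV i₂ (fV j y) , inQR y
      ; fE = λ y → fE i₂ (fE j y) ,
          ∧-intro (subst (T ∘ QR) (sym (src≡ y)) (inQR _)) (subst (T ∘ QR) (sym (tgt≡ y)) (inQR _))
      ; src-comm = λ y → Σ-≡ (src≡ y)
      ; tgt-comm = λ y → Σ-≡ (tgt≡ y)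
      ; tyV-comm = λ y → trans (tyV-comm i₂ _) (tyV-comm j y)
      ; tyE-comm = λ y → trans (tyE-comm i₂ _) (tyE-comm j y)
      }

  module MatchedIso {I L R : TGraph S} (i₁ : Hom I L) (i₂ : Hom I R)
    (emb₁ : BoundaryEmbedding i₁) (emb₂ : BoundaryEmbedding i₂)
    (QL : V L → Bool) (QR : V R → Bool)
    (QL-boundary : ∀ {v} → T (QL v) → Boundary L v) (QR-boundary : ∀ {v} → T (QR v) → Boundary R v)
    (QL-edgeBang : ∀ e → T (QL (src L e)) → T (QL (tgt L e)) → T (isBangV L (src L e)))
    (QR-edgeBang : ∀ e → T (QR (src R e)) → T (QR (tgt R e)) → T (isBangV R (src R e)))
    (corresp→ : ∀ x → T (QL (fV i₁ x)) → T (QR (fV i₂ x)))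
    (corresp← : ∀ x → T (QR (fV i₂ x)) → T (QL (fV i₁ x))) where

    module LR = Transfer i₁ i₂ emb₁ QL QR QL-boundary QL-edgeBang corresp→
    module RL = Transfer i₂ i₁ emb₂ QR QL QR-boundary QR-edgeBang corresp←

    φ : Iso (Sub L QL (allE L)) (Sub R QR (allE R))
    φ = record
      { to = LR.transfer ; from = RL.transfer
      ; from-to-V = λ y → Σ-≡ (trans (cong (fV i₁) (RL.j∘i₁V (fV LR.j y) _)) (LR.i₁∘jV y))
      ; from-to-E = λ y → Σ-≡ (trans (cong (fE i₁) (RL.j∘i₁E (fE LR.j y) _)) (LR.i₁∘jE y))
      ; to-from-V = λ y → Σ-≡ (trans (cong (fV i₂) (LR.j∘i₁V (fV RL.j y) _)) (RL.i₁∘jV y))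
      ; to-from-E = λ y → Σ-≡ (trans (cong (fE i₂) (LR.j∘i₁E (fE RL.j y) _)) (RL.i₁∘jE y))
      }

    j-compat : (RL.j ∘H LR.transfer) ≈H LR.j
    j-compat = (λ y → RL.j∘i₁V (fV LR.j y) _) , (λ y → RL.j∘i₁E (fE LR.j y) _)

  char⇒equation : {L I R : TGraph S} (i₁ : Hom I L) (i₂ : Hom I R) → EquationChar i₁ i₂ → IsEquation i₁ i₂
  char⇒equation {L} {I} {R} i₁ i₂ ch = record
    { L-bgraph = bangGraph⇒isBGraph L (ch-L ch)
    ; I-bgraph = bangGraph⇒isBGraph I (ch-I ch)
    ; R-bgraph = bangGraph⇒isBGraph R (ch-R ch)
    ; L-noIso = wiresIncident⇒noIsolated L (ch-Lwires ch)
    ; R-noIso = wiresIncident⇒noIsolated R (ch-Rwires ch)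
    ; φI = Ins.φ
    ; φO = Outs.φ
    ; φL = BoundaryIso.boundaryIso i₁ (ch-emb₁ ch)
    ; φR = BoundaryIso.boundaryIso i₂ (ch-emb₂ ch)
    ; ιIL = intoBound L (inP L) inL (inEdge-bang L)
    ; ιIR = intoBound R (inP R) inR (inEdge-bang R)
    ; ιOL = intoBound L (outP L) outL (outEdge-bang L)
    ; ιOR = intoBound R (outP R) outR (outEdge-bang R)
    ; ιIL-incl = (λ _ → refl) , (λ _ → refl)
    ; ιIR-incl = (λ _ → refl) , (λ _ → refl)
    ; ιOL-incl = (λ _ → refl) , (λ _ → refl)
    ; ιOR-incl = (λ _ → refl) , (λ _ → refl)
    ; i₁j₁ = Ins.LR.i₁∘jV , Ins.LR.i₁∘jE
    ; i₂j₂ = Ins.RL.i₁∘jV , Ins.RL.i₁∘jE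
    ; j₂φI = Ins.j-compat
    ; i₁k₁ = Outs.LR.i₁∘jV , Outs.LR.i₁∘jE
    ; i₂k₂ = Outs.RL.i₁∘jV , Outs.RL.i₁∘jE
    ; k₂φO = Outs.j-compat
    }
    where
    inL : ∀ {v} → T (inP L v) → Boundary L v
    inL p = in⊆boundary L (inP⇒InBoundary L p)
    inR : ∀ {v} → T (inP R v) → Boundary R v
    inR p = in⊆boundary R (inP⇒InBoundary R p)
    outL : ∀ {v} → T (outP L v) → Boundary L v
    outL p = out⊆boundary L (outP⇒OutBoundary L p)
    outR : ∀ {v} → T (outP R v) → Boundary R v
    outR p = out⊆boundary R (outP⇒OutBoundary R p)
    module Ins = MatchedIso i₁ i₂ (ch-emb₁ ch) (ch-emb₂ ch) (inP L) (inP R) inL inR (inEdge-bang L) (inEdge-bang R)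
      (λ x p → InBoundary⇒inP R (ch-in→ ch x (inP⇒InBoundary L p)))
      (λ x p → InBoundary⇒inP L (ch-in← ch x (inP⇒InBoundary R p)))
    module Outs = MatchedIso i₁ i₂ (ch-emb₁ ch) (ch-emb₂ ch) (outP L) (outP R) outL outR (outEdge-bang L) (outEdge-bang R)
      (λ x p → OutBoundary⇒outP R (ch-out→ ch x (outP⇒OutBoundary L p)))
      (λ x p → OutBoundary⇒outP L (ch-out← ch x (outP⇒OutBoundary R p)))

module _ {S : Sig} where

  -- Since Bound_!(G) is covered
  -- by In_!(G) and Out_!(G), i ∘ φ is the inclusion of Bound_!(G), so i is
  -- a boundary embedding.
  module EquationSide {I G : TGraph S} (i : Hom I G) (φ : Iso (Bound! G) I)
    (ιI : Hom (In! G) (Bound! G)) (ιO : Hom (Out! G) (Bound! G))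
    (ιI-incl : (incl G (boundP G) (boundE G) ∘H ιI) ≈H incl G (inP G) (allE G))
    (ιO-incl : (incl G (boundP G) (boundE G) ∘H ιO) ≈H incl G (outP G) (allE G))
    (i∘j : (i ∘H (to φ ∘H ιI)) ≈H incl G (inP G) (allE G))
    (i∘k : (i ∘H (to φ ∘H ιO)) ≈H incl G (outP G) (allE G)) where

    private
      J = to φ

      viaInV : ∀ v p (q : T (inP G v)) → fV i (fV J (v , p)) ≡ v
      viaInV v p q = trans (cong (fV i ∘ fV J) (sym (Σ-≡ (proj₁ ιI-incl (v , q))))) (proj₁ i∘j (v , q))

      viaOutV : ∀ v p (q : T (outP G v)) → fV i (fV J (v , p)) ≡ v
      viaOutV v p q = trans (cong (fV i ∘ fV J) (sym (Σ-≡ (proj₁ ιO-incl (v , q))))) (proj₁ i∘k (v , q))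

      viaInE : ∀ e p (q : T (inP G (src G e) ∧ inP G (tgt G e))) → fE i (fE J (e , p)) ≡ e
      viaInE e p q = trans (cong (fE i ∘ fE J) (sym (Σ-≡ (proj₂ ιI-incl (e , q))))) (proj₂ i∘j (e , q))

      viaOutE : ∀ e p (q : T (outP G (src G e) ∧ outP G (tgt G e))) → fE i (fE J (e , p)) ≡ e
      viaOutE e p q = trans (cong (fE i ∘ fE J) (sym (Σ-≡ (proj₂ ιO-incl (e , q))))) (proj₂ i∘k (e , q))

    i∘J-V : ∀ y → fV i (fV J y) ≡ proj₁ y
    i∘J-V (v , p) with boundP⇒Boundary G p
    ... | inj₁ b = viaInV v p (InBoundary⇒inP G (inj₁ b))
    ... | inj₂ (inj₁ x) = viaInV v p (InBoundary⇒inP G (inj₂ x))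
    ... | inj₂ (inj₂ x) = viaOutV v p (OutBoundary⇒outP G (inj₂ x))

    -- an edge of Bound_!(G) starts at a !-vertex, so it lies in In_!(G)
    -- or Out_!(G) according to its target
    i∘J-E : ∀ y → fE i (fE J y) ≡ proj₁ y
    i∘J-E (e , q) with boundP⇒Boundary G (∧-snd {boundP G (src G e)} (∧-snd {isBangV G (src G e)} q))
    ... | inj₁ b = viaInE e q (∧-intro (InBoundary⇒inP G (inj₁ (∧-fst q))) (InBoundary⇒inP G (inj₁ b)))
    ... | inj₂ (inj₁ x) = viaInE e q (∧-intro (InBoundary⇒inP G (inj₁ (∧-fst q))) (InBoundary⇒inP G (inj₂ x)))
    ... | inj₂ (inj₂ x) = viaOutE e q (∧-intro (OutBoundary⇒outP G (inj₁ (∧-fst q))) (OutBoundary⇒outP G (inj₂ x)))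

    private
      i-via-fromV : ∀ x → fV i x ≡ proj₁ (fV (from φ) x)
      i-via-fromV x = trans (cong (fV i) (sym (to-from-V φ x))) (i∘J-V (fV (from φ) x))

      i-via-fromE : ∀ x → fE i x ≡ proj₁ (fE (from φ) x)
      i-via-fromE x = trans (cong (fE i) (sym (to-from-E φ x))) (i∘J-E (fE (from φ) x))

    embedding : BoundaryEmbedding i
    embedding = record
      { emb-injV = λ x y eq → trans (sym (to-from-V φ x))
          (trans (cong (fV J) (Σ-≡ (trans (sym (i-via-fromV x)) (trans eq (i-via-fromV y))))) (to-from-V φ y))
      ; emb-injE = λ x y eq → trans (sym (to-from-E φ x))
          (trans (cong (fE J) (Σ-≡ (trans (sym (i-via-fromE x)) (trans eq (i-via-fromE y))))) (to-from-E φ y))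
      ; emb-boundaryV = λ x → subst (Boundary G) (sym (i-via-fromV x)) (boundP⇒Boundary G (proj₂ (fV (from φ) x)))
      ; emb-preimageV = λ v p → fV J (v , Boundary⇒boundP G p) , i∘J-V (v , Boundary⇒boundP G p)
      ; emb-bangE = λ x → subst (λ e → T (isBangV G (src G e))) (sym (i-via-fromE x)) (∧-fst (proj₂ (fE (from φ) x)))
      ; emb-preimageE = λ e bs bt →
          fE J (e , ∧-intro bs (∧-intro (Boundary⇒boundP G (inj₁ bs)) (Boundary⇒boundP G bt))) , i∘J-E _
      }

  module Correspondence {L I R : TGraph S} (i₁ : Hom I L) (i₂ : Hom I R) (QL : V L → Bool) (QR : V R → Bool)
    (φ : Iso (Sub L QL (allE L)) (Sub R QR (allE R)))
    (jL : Hom (Sub L QL (allE L)) I) (jR : Hom (Sub R QR (allE R)) I)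
    (i₁∘jL : ∀ y → fV i₁ (fV jL y) ≡ proj₁ y) (i₂∘jR : ∀ y → fV i₂ (fV jR y) ≡ proj₁ y)
    (jR∘φ : ∀ y → fV jR (fV (to φ) y) ≡ fV jL y)
    (i₁-inj : ∀ x y → fV i₁ x ≡ fV i₁ y → x ≡ y) (i₂-inj : ∀ x y → fV i₂ x ≡ fV i₂ y → x ≡ y) where

    corresp→ : ∀ x → T (QL (fV i₁ x)) → T (QR (fV i₂ x))
    corresp→ x q = subst (T ∘ QR) (sym image) (proj₂ (fV (to φ) z))
      where
      z = (fV i₁ x , q)
      jLz≡x : fV jL z ≡ x
      jLz≡x = i₁-inj _ _ (i₁∘jL z)
      image : fV i₂ x ≡ proj₁ (fV (to φ) z)
      image = trans (cong (fV i₂) (trans (sym jLz≡x) (sym (jR∘φ z)))) (i₂∘jR (fV (to φ) z))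

    corresp← : ∀ x → T (QR (fV i₂ x)) → T (QL (fV i₁ x))
    corresp← x q = subst (T ∘ QL) (sym image) (proj₂ z)
      where
      w = (fV i₂ x , q)
      z = fV (from φ) w
      x≡jLz : x ≡ fV jL z
      x≡jLz = trans (sym (i₂-inj _ _ (i₂∘jR w))) (trans (cong (fV jR) (sym (to-from-V φ w))) (jR∘φ z))
      image : fV i₁ x ≡ proj₁ z
      image = trans (cong (fV i₁) x≡jLz) (i₁∘jL z)

  equation⇒char : {L I R : TGraph S} (i₁ : Hom I L) (i₂ : Hom I R) → IsEquation i₁ i₂ → EquationChar i₁ i₂
  equation⇒char {L} {I} {R} i₁ i₂ eq = record
    { ch-L = isBGraph⇒bangGraph L L-bgraph
    ; ch-I = isBGraph⇒bangGraph I I-bgraph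
    ; ch-R = isBGraph⇒bangGraph R R-bgraph
    ; ch-Lwires = noIsolated⇒wiresIncident L L-noIso
    ; ch-Rwires = noIsolated⇒wiresIncident R R-noIso
    ; ch-emb₁ = Side₁.embedding
    ; ch-emb₂ = Side₂.embedding
    ; ch-in→ = λ x p → inP⇒InBoundary R (Ins.corresp→ x (InBoundary⇒inP L p))
    ; ch-in← = λ x p → inP⇒InBoundary L (Ins.corresp← x (InBoundary⇒inP R p))
    ; ch-out→ = λ x p → outP⇒OutBoundary R (Outs.corresp→ x (OutBoundary⇒outP L p))
    ; ch-out← = λ x p → outP⇒OutBoundary L (Outs.corresp← x (OutBoundary⇒outP R p))
    }
    where
    open IsEquation eq
    module Side₁ = EquationSide i₁ φL ιIL ιOL ιIL-incl ιOL-incl i₁j₁ i₁k₁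
    module Side₂ = EquationSide i₂ φR ιIR ιOR ιIR-incl ιOR-incl i₂j₂ i₂k₂
    module Ins = Correspondence i₁ i₂ (inP L) (inP R) φI (to φL ∘H ιIL) (to φR ∘H ιIR)
      (proj₁ i₁j₁) (proj₁ i₂j₂) (proj₁ j₂φI) (emb-injV Side₁.embedding) (emb-injV Side₂.embedding)
    module Outs = Correspondence i₁ i₂ (outP L) (outP R) φO (to φL ∘H ιOL) (to φR ∘H ιOR)
      (proj₁ i₁k₁) (proj₁ i₂k₂) (proj₁ k₂φO) (emb-injV Side₁.embedding) (emb-injV Side₂.embedding)

module _ {S : Sig} where

  wire⇒nonBang : (G : TGraph S) {v : V G} → T (isWireV G v) → NonBang G v
  wire⇒nonBang G {v} w = kinds (tyV G v) w
    where
    kinds : (t : TV S) → T (isWireT t) → T (not (isBangT t))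
    kinds (wireT _) _ = tt

  record Closed (G : TGraph S) (P : V G → Bool) : Set where
    field
      closed-fixed : ∀ e → IsFixed G e → NonBang G (src G e) → NonBang G (tgt G e) →
        T (P (src G e)) ⊎ T (P (tgt G e)) → T (P (src G e)) × T (P (tgt G e))
      closed-fromWire : ∀ e → NonBang G (src G e) → NonBang G (tgt G e) →
        T (P (src G e)) → T (isWireV G (src G e)) → T (P (tgt G e))
      closed-toWire : ∀ e → NonBang G (src G e) → NonBang G (tgt G e) →
        T (P (tgt G e)) → T (isWireV G (tgt G e)) → T (P (src G e))
  open Closed public

  module ClosedSubgraph (G : TGraph S) (bg : BangGraph G) (P : V G → Bool) (closed : Closed G P) where

    F = Full G P

    edgeUp : ∀ (a c : V F) → Edge G (proj₁ a) (proj₁ c) → Edge F a c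
    edgeUp (x , px) (y , py) (e , refl , refl) = (e , ∧-intro px py) , Σ-≡ refl , Σ-≡ refl

    edgeDown : ∀ {a c : V F} → Edge F a c → Edge G (proj₁ a) (proj₁ c)
    edgeDown ((e , _) , s , t) = e , cong proj₁ s , cong proj₁ t

    private
      endInP : ∀ {n e} → T (P n) → Incident G n e → T (P (src G e)) ⊎ T (P (tgt G e))
      endInP p (inj₁ refl) = inj₁ p
      endInP p (inj₂ refl) = inj₂ p

      restrictString : (Q : V G → Set) → StringOn G (λ v → NonBang G v × Q v) →
        StringOn F (λ x → NonBang G (proj₁ x) × Q (proj₁ x))
      restrictString Q str = stringOn-toFull G P (λ v → NonBang G v × Q v) (stringOn-shrink G str (λ v → proj₂)
        (λ n e pn _ fx i (ns , qs) (nt , qt) →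
          let (ps , pt) = closed-fixed closed e fx ns nt (endInP (proj₁ pn) i) in (ps , ns , qs) , (pt , nt , qt)))

      poset : BangPoset F
      poset = record
        { po-unique = λ (e , _) (e' , _) bs bt s t →
            Σ-≡ (po-unique (bang-poset bg) e e' bs bt (cong proj₁ s) (cong proj₁ t))
        ; po-refl = λ (v , p) b → edgeUp (v , p) (v , p) (po-refl (bang-poset bg) v b)
        ; po-trans = λ x y z bx by bz e₁ e₂ →
            edgeUp x z (po-trans (bang-poset bg) _ _ _ bx by bz (edgeDown e₁) (edgeDown e₂))
        ; po-antisym = λ x y bx by e₁ e₂ → Σ-≡ (po-antisym (bang-poset bg) _ _ bx by (edgeDown e₁) (edgeDown e₂))
        }

      openBox : ∀ b → T (isBangV F b) → OpenBox F b
      openBox (b , pb) bb = record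
        { box-string = stringOn-⇔ F (λ (v , _) (nb , eb) → nb , edgeDown eb) (λ (v , pv) (nb , eb) → nb , edgeUp (b , pb) (v , pv) eb)
            (restrictString (Edge G b) (box-string o))
        ; box-noWireOut = λ (e , _) ns nt eb neb wi →
            box-noWireOut o e ns nt (edgeDown eb) (neb ∘ edgeUp (b , pb) _) wi
        ; box-noWireIn = λ (e , _) ns nt eb neb wi →
            box-noWireIn o e ns nt (edgeDown eb) (neb ∘ edgeUp (b , pb) _) wi
        ; box-fixed = λ (e , _) ns nt fx ends →
            let (s , t) = box-fixed o e ns nt fx (⊎-map edgeDown edgeDown ends) in
            edgeUp (b , pb) _ s , edgeUp (b , pb) _ t
        }
        where o = bang-open bg b bb

    restrict-bangGraph : BangGraph F
    restrict-bangGraph = record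
      { bang-string = stringOn-⇔ F (λ v nb → nb , tt) (λ v → proj₁) (restrictString (λ _ → ⊤)
          (stringOn-⇔ G (λ v → proj₁) (λ v nb → nb , tt) (bang-string bg)))
      ; bang-poset = poset
      ; bang-open = openBox
      ; bang-nested = λ b b' bb bb' e₁ v e₂ → edgeUp b v (bang-nested bg _ _ bb bb' (edgeDown e₁) _ (edgeDown e₂))
      }

    restrict-wiresIncident : WiresIncident G → WiresIncident F
    restrict-wiresIncident wires (w , p) nb wi with wires w nb wi
    ... | e , ns , nt , inj₁ refl = (e , ∧-intro p (closed-fromWire closed e ns nt p wi)) , ns , nt , inj₁ (Σ-≡ refl)
    ... | e , ns , nt , inj₂ refl = (e , ∧-intro (closed-toWire closed e ns nt p wi) p) , ns , nt , inj₂ (Σ-≡ refl)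

    input↓ : ∀ {v p} → IsInput F (v , p) → IsInput G v
    input↓ {v} {p} (wi , fromBang) = wi , bangSource
      where
      bangSource : ∀ e → tgt G e ≡ v → T (isBangV G (src G e))
      bangSource e t with T? (isBangV G (src G e))
      ... | yes b = b
      bangSource e refl | no nb =
        fromBang (e , ∧-intro (closed-toWire closed e (not-intro nb) (wire⇒nonBang G wi) p wi) p) (Σ-≡ refl)

    input↑ : ∀ {v p} → IsInput G v → IsInput F (v , p)
    input↑ (wi , fromBang) = wi , λ (e , _) t → fromBang e (cong proj₁ t)

    output↓ : ∀ {v p} → IsOutput F (v , p) → IsOutput G v
    output↓ {v} {p} (wi , toBang) = wi , bangTarget
      where
      bangTarget : ∀ e → src G e ≡ v → T (isBangV G (tgt G e))
      bangTarget e s with T? (isBangV G (tgt G e))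
      ... | yes b = b
      bangTarget e refl | no nb =
        toBang (e , ∧-intro p (closed-fromWire closed e (wire⇒nonBang G wi) (not-intro nb) p wi)) (Σ-≡ refl)

    output↑ : ∀ {v p} → IsOutput G v → IsOutput F (v , p)
    output↑ (wi , toBang) = wi , λ (e , _) s → toBang e (cong proj₁ s)

    boundary↓ : ∀ {v p} → Boundary F (v , p) → Boundary G v
    boundary↓ = ⊎-map id (⊎-map input↓ output↓)

    boundary↑ : ∀ {v p} → Boundary G v → Boundary F (v , p)
    boundary↑ = ⊎-map id (⊎-map input↑ output↑)

    inBoundary↓ : ∀ {v p} → InBoundary F (v , p) → InBoundary G v
    inBoundary↓ = ⊎-map id input↓

    inBoundary↑ : ∀ {v p} → InBoundary G v → InBoundary F (v , p)
    inBoundary↑ = ⊎-map id input↑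

    outBoundary↓ : ∀ {v p} → OutBoundary F (v , p) → OutBoundary G v
    outBoundary↓ = ⊎-map id output↓

    outBoundary↑ : ∀ {v p} → OutBoundary G v → OutBoundary F (v , p)
    outBoundary↑ = ⊎-map id output↑

  restrictHom : {I L : TGraph S} (i : Hom I L) (PI : V I → Bool) (PL : V L → Bool) →
    (∀ x → T (PI x) → T (PL (fV i x))) → Hom (Full I PI) (Full L PL)
  restrictHom {L = L} i PI PL maps = record
    { fV = λ (x , p) → fV i x , maps x p
    ; fE = λ (e , q) → fE i e , ∧-intro (subst (T ∘ PL) (sym (src-comm i e)) (maps _ (∧-fst q)))
                                        (subst (T ∘ PL) (sym (tgt-comm i e)) (maps _ (∧-snd q)))
    ; src-comm = λ (e , _) → Σ-≡ (src-comm i e)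
    ; tgt-comm = λ (e , _) → Σ-≡ (tgt-comm i e)
    ; tyV-comm = λ (x , _) → tyV-comm i x
    ; tyE-comm = λ (e , _) → tyE-comm i e
    }

  restrictHom-isRestriction : {I L : TGraph S} (i : Hom I L) (PI : V I → Bool) (PL : V L → Bool) →
    (maps : ∀ x → T (PI x) → T (PL (fV i x))) →
    IsRestriction PI (allE I) PL (allE L) i (restrictHom i PI PL maps)
  restrictHom-isRestriction i PI PL maps = (λ _ → refl) , (λ _ → refl)

  restrict-embedding : {I L : TGraph S} (i : Hom I L) → BoundaryEmbedding i →
    (PI : V I → Bool) (PL : V L → Bool) →
    (maps : ∀ x → T (PI x) → T (PL (fV i x))) → (∀ x → T (PL (fV i x)) → T (PI x)) →
    BangGraph L → Closed L PL → BoundaryEmbedding (restrictHom i PI PL maps)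
  restrict-embedding {L = L} i emb PI PL maps reflects bgL closedL = record
    { emb-injV = λ (x , _) (y , _) eq → Σ-≡ (emb-injV emb x y (cong proj₁ eq))
    ; emb-injE = λ (x , _) (y , _) eq → Σ-≡ (emb-injE emb x y (cong proj₁ eq))
    ; emb-boundaryV = λ (x , _) → FL.boundary↑ (emb-boundaryV emb x)
    ; emb-preimageV = λ (v , p) bd →
        let (x , eq) = emb-preimageV emb v (FL.boundary↓ bd) in
        (x , reflects x (subst (T ∘ PL) (sym eq) p)) , Σ-≡ eq
    ; emb-bangE = λ (e , _) → emb-bangE emb e
    ; emb-preimageE = λ (e , q) bs bt →
        let (d , eq) = emb-preimageE emb e bs (FL.boundary↓ bt) in
        (d , ∧-intro (reflects _ (subst (T ∘ PL) (sym (trans (sym (src-comm i d)) (cong (src L) eq))) (∧-fst q)))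
                     (reflects _ (subst (T ∘ PL) (sym (trans (sym (tgt-comm i d)) (cong (tgt L) eq))) (∧-snd q))))
        , Σ-≡ eq
    }
    where module FL = ClosedSubgraph L bgL PL closedL

  restrictEquation : {L I R : TGraph S} (i₁ : Hom I L) (i₂ : Hom I R) (ch : EquationChar i₁ i₂)
    (PL : V L → Bool) (PI : V I → Bool) (PR : V R → Bool) →
    Closed L PL → Closed I PI → Closed R PR →
    (maps₁ : ∀ x → T (PI x) → T (PL (fV i₁ x))) → (∀ x → T (PL (fV i₁ x)) → T (PI x)) →
    (maps₂ : ∀ x → T (PI x) → T (PR (fV i₂ x))) → (∀ x → T (PR (fV i₂ x)) → T (PI x)) →
    EquationChar (restrictHom i₁ PI PL maps₁) (restrictHom i₂ PI PR maps₂)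
  restrictEquation i₁ i₂ ch PL PI PR closedL closedI closedR maps₁ reflects₁ maps₂ reflects₂ = record
    { ch-L = FL.restrict-bangGraph
    ; ch-I = FI.restrict-bangGraph
    ; ch-R = FR.restrict-bangGraph
    ; ch-Lwires = FL.restrict-wiresIncident (ch-Lwires ch)
    ; ch-Rwires = FR.restrict-wiresIncident (ch-Rwires ch)
    ; ch-emb₁ = restrict-embedding i₁ (ch-emb₁ ch) PI PL maps₁ reflects₁ (ch-L ch) closedL
    ; ch-emb₂ = restrict-embedding i₂ (ch-emb₂ ch) PI PR maps₂ reflects₂ (ch-R ch) closedR
    ; ch-in→ = λ (x , _) h → FR.inBoundary↑ (ch-in→ ch x (FL.inBoundary↓ h))
    ; ch-in← = λ (x , _) h → FL.inBoundary↑ (ch-in← ch x (FR.inBoundary↓ h))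
    ; ch-out→ = λ (x , _) h → FR.outBoundary↑ (ch-out→ ch x (FL.outBoundary↓ h))
    ; ch-out← = λ (x , _) h → FL.outBoundary↑ (ch-out← ch x (FR.outBoundary↓ h))
    }
    where
    module FL = ClosedSubgraph _ (ch-L ch) PL closedL
    module FI = ClosedSubgraph _ (ch-I ch) PI closedI
    module FR = ClosedSubgraph _ (ch-R ch) PR closedR

  RestrictedSpan : {L I R : TGraph S} (i₁ : Hom I L) (i₂ : Hom I R) →
    (V L → Bool) → (V I → Bool) → (V R → Bool) → Set
  RestrictedSpan {L} {I} {R} i₁ i₂ PL PI PR =
    Σ (Hom (Full I PI) (Full L PL)) λ g₁ →
    Σ (Hom (Full I PI) (Full R PR)) λ g₂ →
      IsRestriction PI (allE I) PL (allE L) i₁ g₁ ×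
      IsRestriction PI (allE I) PR (allE R) i₂ g₂ ×
      IsEquation g₁ g₂

  restrictSpan : {L I R : TGraph S} (i₁ : Hom I L) (i₂ : Hom I R) (ch : EquationChar i₁ i₂)
    (PL : V L → Bool) (PI : V I → Bool) (PR : V R → Bool) →
    Closed L PL → Closed I PI → Closed R PR →
    (∀ x → T (PI x) → T (PL (fV i₁ x))) → (∀ x → T (PL (fV i₁ x)) → T (PI x)) →
    (∀ x → T (PI x) → T (PR (fV i₂ x))) → (∀ x → T (PR (fV i₂ x)) → T (PI x)) →
    RestrictedSpan i₁ i₂ PL PI PR
  restrictSpan i₁ i₂ ch PL PI PR closedL closedI closedR maps₁ reflects₁ maps₂ reflects₂ =
    restrictHom i₁ PI PL maps₁ , restrictHom i₂ PI PR maps₂ ,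
    restrictHom-isRestriction i₁ PI PL maps₁ , restrictHom-isRestriction i₂ PI PR maps₂ ,
    char⇒equation _ _ (restrictEquation i₁ i₂ ch PL PI PR closedL closedI closedR maps₁ reflects₁ maps₂ reflects₂)

  embedding-reflectsBox : {I L : TGraph S} (i : Hom I L) → BoundaryEmbedding i →
    ∀ {b x} → T (isBangV I b) → Edge L (fV i b) (fV i x) → Edge I b x
  embedding-reflectsBox {I} {L} i emb {b} {x} bb (e , s , t) =
    d , emb-injV emb _ _ (trans (sym (src-comm i d)) (trans (cong (src L) i[d]≡e) s))
      , emb-injV emb _ _ (trans (sym (tgt-comm i d)) (trans (cong (tgt L) i[d]≡e) t))
    where
    bangSource : T (isBangV L (src L e))
    bangSource = subst (T ∘ isBangV L) (sym s) (subst T (sym (bang-pres i b)) bb)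
    preimage = emb-preimageE emb e bangSource (subst (Boundary L) (sym t) (emb-boundaryV emb x))
    d = proj₁ preimage
    i[d]≡e = proj₂ preimage

  -- DROP_b: every vertex of U(G) survives, so G ∖ {b} is trivially closed
  drop-closed : (G : TGraph S) (b : V G) → T (isBangV G b) → Closed G (dropP G b)
  drop-closed G b bb = record
    { closed-fixed = λ e _ ns nt _ → kept ns , kept nt
    ; closed-fromWire = λ e _ nt _ _ → kept nt
    ; closed-toWire = λ e ns _ _ _ → kept ns
    }
    where
    kept : ∀ {v} → NonBang G v → T (dropP G b v)
    kept {v} nb = not-intro λ v≡b → not-elim nb (subst (T ∘ isBangV G) (sym (≟-sound G v≡b)) bb)

  -- KILL_b: G ∖ B(b) is closed because U(B(b)) is open in U(G)
  kill-closed : (G : TGraph S) → BangGraph G → (b : V G) → T (isBangV G b) → Closed G (killP G b)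
  kill-closed G bg b bb = record
    { closed-fixed = λ where
        e fx ns nt (inj₁ ps) → ps , not-intro λ it →
          not-elim ps (Edge⇒inB G (proj₁ (box-fixed o e ns nt fx (inj₂ (inB⇒Edge G it)))))
        e fx ns nt (inj₂ pt) → (not-intro λ is →
          not-elim pt (Edge⇒inB G (proj₂ (box-fixed o e ns nt fx (inj₁ (inB⇒Edge G is)))))) , pt
    ; closed-fromWire = λ e ns nt ps wi → not-intro λ it →
        box-noWireIn o e ns nt (inB⇒Edge G it) (not-elim ps ∘ Edge⇒inB G) wi
    ; closed-toWire = λ e ns nt pt wi → not-intro λ is →
        box-noWireOut o e ns nt (inB⇒Edge G is) (not-elim pt ∘ Edge⇒inB G) wi
    }
    where o = bang-open bg b bb

  module _ {L I R : TGraph S} (i₁ : Hom I L) (i₂ : Hom I R) (ch : EquationChar i₁ i₂)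
    (b : V I) (bb : T (isBangV I b)) where
    private
      bangImage : ∀ {X} (i : Hom I X) → T (isBangV X (fV i b))
      bangImage i = subst T (sym (bang-pres i b)) bb

      drop-maps : ∀ {X} (i : Hom I X) → BoundaryEmbedding i → ∀ x → T (dropP I b x) → T (dropP X (fV i b) (fV i x))
      drop-maps {X} i emb x p = not-intro λ eq → not-elim p (≟-complete I (emb-injV emb _ _ (≟-sound X eq)))

      drop-reflects : ∀ {X} (i : Hom I X) → ∀ x → T (dropP X (fV i b) (fV i x)) → T (dropP I b x)
      drop-reflects {X} i x p = not-intro λ eq → not-elim p (≟-complete X (cong (fV i) (≟-sound I eq)))

      -- x ∉ B(b) iff i(x) ∉ B(i(b)): i preserves edges and reflects those out of !-vertices
      kill-maps : ∀ {X} (i : Hom I X) → BoundaryEmbedding i → ∀ x → T (killP I b x) → T (killP X (fV i b) (fV i x))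
      kill-maps {X} i emb x p = not-intro λ h → not-elim p (Edge⇒inB I (embedding-reflectsBox i emb bb (inB⇒Edge X h)))

      kill-reflects : ∀ {X} (i : Hom I X) → ∀ x → T (killP X (fV i b) (fV i x)) → T (killP I b x)
      kill-reflects {X} i x p = not-intro λ h → not-elim p (Edge⇒inB X (edge-pres i (inB⇒Edge I h)))

    dropEquation : RestrictedSpan i₁ i₂ (dropP L (fV i₁ b)) (dropP I b) (dropP R (fV i₂ b))
    dropEquation = restrictSpan i₁ i₂ ch _ _ _
      (drop-closed L _ (bangImage i₁)) (drop-closed I b bb) (drop-closed R _ (bangImage i₂))
      (drop-maps i₁ (ch-emb₁ ch)) (drop-reflects i₁) (drop-maps i₂ (ch-emb₂ ch)) (drop-reflects i₂)

    killEquation : RestrictedSpan i₁ i₂ (killP L (fV i₁ b)) (killP I b) (killP R (fV i₂ b))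
    killEquation = restrictSpan i₁ i₂ ch _ _ _
      (kill-closed L (ch-L ch) _ (bangImage i₁)) (kill-closed I (ch-I ch) b bb) (kill-closed R (ch-R ch) _ (bangImage i₂))
      (kill-maps i₁ (ch-emb₁ ch)) (kill-reflects i₁) (kill-maps i₂ (ch-emb₂ ch)) (kill-reflects i₂)

-- The folding
-- map π : COPY_b(G) → G identifies the copies; everything about COPY_b(G)
-- is transported along π.

module _ {S : Sig} where

  module CopyBasics (G : TGraph S) (b : V G) where
    Cg = COPY G b

    InB : V G → Set
    InB v = T (inB G b v)

    πV : CV G b → V G
    πV (inj₁ v) = v
    πV (inj₂ (v , _)) = v

    πE : CE G b → E G
    πE (inj₁ e) = e
    πE (inj₂ (e , _)) = e

    p2V-cases : ∀ u → (¬ InB u × p2V G b u ≡ inj₁ u) ⊎ (Σ (InB u) λ p → p2V G b u ≡ inj₂ (u , p))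
    p2V-cases u = cases (inB G b u) refl
      where
      cases : ∀ c (eq : c ≡ inB G b u) →
        (¬ InB u × p2Vaux G b u c eq ≡ inj₁ u) ⊎ (Σ (InB u) λ p → p2Vaux G b u c eq ≡ inj₂ (u , p))
      cases true eq = inj₂ (subst T eq tt , refl)
      cases false eq = inj₁ (subst T (sym eq) , refl)

    p2V-in : ∀ u (p : InB u) → p2V G b u ≡ inj₂ (u , p)
    p2V-in u p with p2V-cases u
    ... | inj₁ (out , _) = ⊥-elim (out p)
    ... | inj₂ (p' , eq) = trans eq (cong (λ z → inj₂ (u , z)) (T-irr p' p))

    p2V-out : ∀ u → ¬ InB u → p2V G b u ≡ inj₁ u
    p2V-out u out with p2V-cases u
    ... | inj₁ (_ , eq) = eq
    ... | inj₂ (p , _) = ⊥-elim (out p)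

    π∘p2V : ∀ u → πV (p2V G b u) ≡ u
    π∘p2V u with p2V-cases u
    ... | inj₁ (_ , eq) = cong πV eq
    ... | inj₂ (_ , eq) = cong πV eq

    p2V-first⇒outside : ∀ {u w} → p2V G b u ≡ inj₁ w → ¬ InB u
    p2V-first⇒outside {u} eq p with trans (sym (p2V-in u p)) eq
    ... | ()

    p2E-cases : ∀ e → (¬ T (touchB G b e) × p2E G b e ≡ inj₁ e) ⊎ (Σ (T (touchB G b e)) λ t → p2E G b e ≡ inj₂ (e , t))
    p2E-cases e = cases (touchB G b e) refl
      where
      cases : ∀ c (eq : c ≡ touchB G b e) →
        (¬ T (touchB G b e) × p2Eaux G b e c eq ≡ inj₁ e) ⊎ (Σ (T (touchB G b e)) λ t → p2Eaux G b e c eq ≡ inj₂ (e , t))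
      cases true eq = inj₂ (subst T eq tt , refl)
      cases false eq = inj₁ (subst T (sym eq) , refl)

    touch-tgt : ∀ {d} → T (touchB G b d) → ¬ InB (src G d) → InB (tgt G d)
    touch-tgt t out with ∨-cases t
    ... | inj₁ p = ⊥-elim (out p)
    ... | inj₂ p = p

    touch-src : ∀ {d} → T (touchB G b d) → ¬ InB (tgt G d) → InB (src G d)
    touch-src t out with ∨-cases t
    ... | inj₁ p = p
    ... | inj₂ p = ⊥-elim (out p)

    π : Hom Cg G
    π = record
      { fV = πV ; fE = πE
      ; src-comm = λ { (inj₁ e) → refl ; (inj₂ (e , _)) → sym (π∘p2V (src G e)) }
      ; tgt-comm = λ { (inj₁ e) → refl ; (inj₂ (e , _)) → sym (π∘p2V (tgt G e)) }
      ; tyV-comm = λ { (inj₁ v) → refl ; (inj₂ _) → refl }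
      ; tyE-comm = λ { (inj₁ e) → refl ; (inj₂ _) → refl }
      }

    src-π : ∀ e → src G (πE e) ≡ πV (cSrc G b e)
    src-π = src-comm π

    tgt-π : ∀ e → tgt G (πE e) ≡ πV (cTgt G b e)
    tgt-π = tgt-comm π

    nonBang-π : ∀ x → NonBang Cg x → NonBang G (πV x)
    nonBang-π (inj₁ _) n = n
    nonBang-π (inj₂ _) n = n

    nonBang-π⁻ : ∀ x → NonBang G (πV x) → NonBang Cg x
    nonBang-π⁻ (inj₁ _) n = n
    nonBang-π⁻ (inj₂ _) n = n

    bang-π : ∀ x → T (isBangV Cg x) → T (isBangV G (πV x))
    bang-π x = subst T (sym (bang-pres π x))

    bang-π⁻ : ∀ x → T (isBangV G (πV x)) → T (isBangV Cg x)
    bang-π⁻ x = subst T (bang-pres π x)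

    wire-π : ∀ x → T (isWireV Cg x) → T (isWireV G (πV x))
    wire-π x = subst T (sym (wire-pres π x))

    -- Compatible x y: an edge of G between πV x and πV y lifts to one
    -- between x and y.  Only a vertex outside B(b) is shared by both
    -- copies, so mixing copies requires the first-copy end to lie outside B(b).
    Compatible : CV G b → CV G b → Set
    Compatible (inj₁ v) (inj₂ _) = ¬ InB v
    Compatible (inj₂ _) (inj₁ w) = ¬ InB w
    Compatible (inj₁ _) (inj₁ _) = ⊤
    Compatible (inj₂ _) (inj₂ _) = ⊤

    compatible-sym : ∀ x y → Compatible x y → Compatible y x
    compatible-sym (inj₁ _) (inj₁ _) c = tt
    compatible-sym (inj₁ _) (inj₂ _) c = c
    compatible-sym (inj₂ _) (inj₁ _) c = c
    compatible-sym (inj₂ _) (inj₂ _) c = tt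

    compatible-refl : ∀ x → Compatible x x
    compatible-refl (inj₁ _) = tt
    compatible-refl (inj₂ _) = tt

    compatible-p2V : ∀ u w → Compatible (p2V G b u) (p2V G b w)
    compatible-p2V u w with p2V-cases u | p2V-cases w
    ... | inj₁ (_ , eu) | inj₁ (_ , ew) rewrite eu | ew = tt
    ... | inj₁ (out , eu) | inj₂ (_ , ew) rewrite eu | ew = out
    ... | inj₂ (_ , eu) | inj₁ (out , ew) rewrite eu | ew = out
    ... | inj₂ (_ , eu) | inj₂ (_ , ew) rewrite eu | ew = tt

    compatible-edge : ∀ e → Compatible (cSrc G b e) (cTgt G b e)
    compatible-edge (inj₁ _) = tt
    compatible-edge (inj₂ (d , _)) = compatible-p2V (src G d) (tgt G d)

    lift : ∀ x z d → src G d ≡ πV x → tgt G d ≡ πV z → Compatible x z →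
      Σ (CE G b) λ e → cSrc G b e ≡ x × cTgt G b e ≡ z × πE e ≡ d
    lift (inj₁ v) (inj₁ w) d s t c = inj₁ d , cong inj₁ s , cong inj₁ t , refl
    lift (inj₁ v) (inj₂ (w , p)) d s t c =
      inj₂ (d , ∨-inr {inB G b (src G d)} (subst InB (sym t) p)) ,
      trans (cong (p2V G b) s) (p2V-out v c) , trans (cong (p2V G b) t) (p2V-in w p) , refl
    lift (inj₂ (v , p)) (inj₁ w) d s t c =
      inj₂ (d , ∨-inl (subst InB (sym s) p)) ,
      trans (cong (p2V G b) s) (p2V-in v p) , trans (cong (p2V G b) t) (p2V-out w c) , refl
    lift (inj₂ (v , p)) (inj₂ (w , q)) d s t c =
      inj₂ (d , ∨-inl (subst InB (sym s) p)) ,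
      trans (cong (p2V G b) s) (p2V-in v p) , trans (cong (p2V G b) t) (p2V-in w q) , refl

    liftSrc : ∀ x d → src G d ≡ πV x → Σ (CE G b) λ e → cSrc G b e ≡ x × πE e ≡ d
    liftSrc (inj₁ v) d s = inj₁ d , cong inj₁ s , refl
    liftSrc (inj₂ (v , p)) d s = inj₂ (d , ∨-inl (subst InB (sym s) p)) , trans (cong (p2V G b) s) (p2V-in v p) , refl

    liftTgt : ∀ x d → tgt G d ≡ πV x → Σ (CE G b) λ e → cTgt G b e ≡ x × πE e ≡ d
    liftTgt (inj₁ v) d t = inj₁ d , cong inj₁ t , refl
    liftTgt (inj₂ (v , p)) d t =
      inj₂ (d , ∨-inr {inB G b (src G d)} (subst InB (sym t) p)) , trans (cong (p2V G b) t) (p2V-in v p) , refl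

    edge-lift : ∀ {x z} → Edge G (πV x) (πV z) → Compatible x z → Edge Cg x z
    edge-lift {x} {z} (d , s , t) c = let (e , s' , t' , _) = lift x z d s t c in e , s' , t'

    edge-project : ∀ {x z} → Edge Cg x z → Edge G (πV x) (πV z) × Compatible x z
    edge-project (e , refl , refl) = edge-pres π (e , refl , refl) , compatible-edge e

    π-injective : ∀ x y → πV x ≡ πV y → Compatible x y → x ≡ y
    π-injective (inj₁ v) (inj₁ w) eq c = cong inj₁ eq
    π-injective (inj₁ v) (inj₂ (w , q)) eq c = ⊥-elim (c (subst InB (sym eq) q))
    π-injective (inj₂ (v , p)) (inj₁ w) eq c = ⊥-elim (c (subst InB eq p))
    π-injective (inj₂ (v , p)) (inj₂ (w , q)) eq c = cong inj₂ (Σ-≡ eq)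

    π-injectiveE : ∀ e e' → cSrc G b e ≡ cSrc G b e' → cTgt G b e ≡ cTgt G b e' → πE e ≡ πE e' → e ≡ e'
    π-injectiveE (inj₁ d) (inj₁ d') s t eq = cong inj₁ eq
    π-injectiveE (inj₂ (d , _)) (inj₂ (d' , _)) s t eq = cong inj₂ (Σ-≡ eq)
    π-injectiveE (inj₁ d) (inj₂ (d , p)) s t refl =
      ⊥-elim (p2V-first⇒outside (sym t) (touch-tgt p (p2V-first⇒outside (sym s))))
    π-injectiveE (inj₂ (d , p)) (inj₁ d) s t refl =
      ⊥-elim (p2V-first⇒outside t (touch-tgt p (p2V-first⇒outside s)))

    input-π : ∀ {x} → IsInput Cg x → IsInput G (πV x)
    input-π {x} (wi , fromBang) = wire-π x wi , λ d t →
      let (e , t' , pe) = liftTgt x d t in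
      subst (T ∘ isBangV G) (trans (sym (src-π e)) (cong (src G) pe)) (bang-π (cSrc G b e) (fromBang e t'))

    input-π⁻ : ∀ {x} → IsInput G (πV x) → IsInput Cg x
    input-π⁻ {x} (wi , fromBang) = subst T (wire-pres π x) wi , λ e t →
      bang-π⁻ (cSrc G b e) (subst (T ∘ isBangV G) (src-π e) (fromBang (πE e) (trans (tgt-π e) (cong πV t))))

    output-π : ∀ {x} → IsOutput Cg x → IsOutput G (πV x)
    output-π {x} (wi , toBang) = wire-π x wi , λ d s →
      let (e , s' , pe) = liftSrc x d s in
      subst (T ∘ isBangV G) (trans (sym (tgt-π e)) (cong (tgt G) pe)) (bang-π (cTgt G b e) (toBang e s'))

    output-π⁻ : ∀ {x} → IsOutput G (πV x) → IsOutput Cg x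
    output-π⁻ {x} (wi , toBang) = subst T (wire-pres π x) wi , λ e s →
      bang-π⁻ (cTgt G b e) (subst (T ∘ isBangV G) (tgt-π e) (toBang (πE e) (trans (src-π e) (cong πV s))))

    boundary-π : ∀ {x} → Boundary Cg x → Boundary G (πV x)
    boundary-π {x} = ⊎-map (bang-π x) (⊎-map input-π output-π)

    boundary-π⁻ : ∀ {x} → Boundary G (πV x) → Boundary Cg x
    boundary-π⁻ {x} = ⊎-map (bang-π⁻ x) (⊎-map input-π⁻ output-π⁻)

    inBoundary-π : ∀ {x} → InBoundary Cg x → InBoundary G (πV x)
    inBoundary-π {x} = ⊎-map (bang-π x) input-π

    inBoundary-π⁻ : ∀ {x} → InBoundary G (πV x) → InBoundary Cg x
    inBoundary-π⁻ {x} = ⊎-map (bang-π⁻ x) input-π⁻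

    outBoundary-π : ∀ {x} → OutBoundary Cg x → OutBoundary G (πV x)
    outBoundary-π {x} = ⊎-map (bang-π x) output-π

    outBoundary-π⁻ : ∀ {x} → OutBoundary G (πV x) → OutBoundary Cg x
    outBoundary-π⁻ {x} = ⊎-map (bang-π⁻ x) output-π⁻

  -- in 𝒢_{T!} no edge joins two node-vertices
  no-node-loop : (G : TGraph S) → ∀ d → src G d ≡ tgt G d → T (isNodeV G (src G d)) → ⊥
  no-node-loop G d eq nd = typegraph (tyE G d) (subst (T ∘ isNodeT) (sym (src-ty G d)) nd)
                              (subst (T ∘ isNodeT) (sym (tgt-ty G d)) (subst (T ∘ isNodeV G) eq nd))
    where
    typegraph : ∀ t → T (isNodeT (srcT S t)) → T (isNodeT (tgtT S t)) → ⊥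
    typegraph (outT f j) _ ()

  module CopyBangGraph (G : TGraph S) (bg : BangGraph G) (b : V G) (bb : T (isBangV G b)) where
    open CopyBasics G b public
    private
      o = bang-open bg b bb

    box-nested : ∀ v u → T (isBangV G v) → InB v → Edge G v u → InB u
    box-nested v u vb p e = Edge⇒inB G (bang-nested bg b v bb vb (inB⇒Edge G p) u e)

    compatible-trans : ∀ x y z → T (isBangV G (πV x)) → Edge G (πV x) (πV y) →
      Compatible x y → Compatible y z → Compatible x z
    compatible-trans (inj₁ v) (inj₁ u) (inj₂ _) bx e cxy cyz = λ iv → cyz (box-nested v u bx iv e)
    compatible-trans (inj₁ v) (inj₂ _) (inj₂ _) bx e cxy cyz = cxy
    compatible-trans (inj₂ (v , p)) (inj₁ u) (inj₁ w) bx e cxy cyz = ⊥-elim (cxy (box-nested v u bx p e))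
    compatible-trans (inj₂ _) (inj₂ _) (inj₁ w) bx e cxy cyz = cyz
    compatible-trans (inj₁ _) _ (inj₁ _) bx e cxy cyz = tt
    compatible-trans (inj₂ _) _ (inj₂ _) bx e cxy cyz = tt

    -- π is injective on the edges of U(COPY_b(G)) into a common wire: both
    -- copies of an edge d could only share their target if it lay outside
    -- B(b) while the source lies inside, but B(b) is open.
    π-injective-wireIn : ∀ e e' → NonBang Cg (cSrc G b e) → NonBang Cg (cSrc G b e') →
      cTgt G b e ≡ cTgt G b e' → T (isWireV Cg (cTgt G b e)) → πE e ≡ πE e' → e ≡ e'
    π-injective-wireIn (inj₁ d) (inj₁ d') _ _ _ _ eq = cong inj₁ eq
    π-injective-wireIn (inj₂ (d , _)) (inj₂ (d' , _)) _ _ _ _ eq = cong inj₂ (Σ-≡ eq)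
    π-injective-wireIn (inj₁ d) (inj₂ (d , p)) ns _ t wi refl =
      let tgtOut = p2V-first⇒outside (sym t) in
      ⊥-elim (box-noWireOut o d ns (wire⇒nonBang G wi) (inB⇒Edge G (touch-src p tgtOut)) (tgtOut ∘ Edge⇒inB G) wi)
    π-injective-wireIn (inj₂ (d , p)) (inj₁ d) ns ns' t wi refl =
      sym (π-injective-wireIn (inj₁ d) (inj₂ (d , p)) ns' ns (sym t) (subst (T ∘ isWireV Cg) t wi) refl)

    π-injective-wireOut : ∀ e e' → NonBang Cg (cTgt G b e) → NonBang Cg (cTgt G b e') →
      cSrc G b e ≡ cSrc G b e' → T (isWireV Cg (cSrc G b e)) → πE e ≡ πE e' → e ≡ e'
    π-injective-wireOut (inj₁ d) (inj₁ d') _ _ _ _ eq = cong inj₁ eq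
    π-injective-wireOut (inj₂ (d , _)) (inj₂ (d' , _)) _ _ _ _ eq = cong inj₂ (Σ-≡ eq)
    π-injective-wireOut (inj₁ d) (inj₂ (d , p)) nt _ s wi refl =
      let srcOut = p2V-first⇒outside (sym s) in
      ⊥-elim (box-noWireIn o d (wire⇒nonBang G wi) nt (inB⇒Edge G (touch-tgt p srcOut)) (srcOut ∘ Edge⇒inB G) wi)
    π-injective-wireOut (inj₂ (d , p)) (inj₁ d) nt nt' s wi refl =
      sym (π-injective-wireOut (inj₁ d) (inj₂ (d , p)) nt' nt (sym s) (subst (T ∘ isWireV Cg) s wi) refl)

    -- the two copies of a fixed-arity edge d of U(G) never share a
    -- node-vertex: sharing an end means that end lies outside B(b), hence
    -- (d being fixed and touching B(b)) so does the other end; sharing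
    -- opposite ends would make d a loop at a node.
    copies-notAtSameNode : ∀ n d (p : T (touchB G b d)) → NonBang G (src G d) → NonBang G (tgt G d) → IsFixed G d →
      Incident Cg n (inj₁ d) → Incident Cg n (inj₂ (d , p)) → T (isNodeV Cg n) → ⊥
    copies-notAtSameNode n d p ns nt fx (inj₁ s) (inj₁ s') nd =
      let srcOut = p2V-first⇒outside (trans s' (sym s)) in
      srcOut (Edge⇒inB G (proj₁ (box-fixed o d ns nt fx (inj₂ (inB⇒Edge G (touch-tgt p srcOut))))))
    copies-notAtSameNode n d p ns nt fx (inj₁ s) (inj₂ t') nd =
      no-node-loop G d (trans (cong πV (trans s (sym t'))) (π∘p2V (tgt G d))) (subst (T ∘ isNodeV Cg) (sym s) nd)
    copies-notAtSameNode n d p ns nt fx (inj₂ t) (inj₁ s') nd =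
      let tgt≡src = trans (cong πV (trans t (sym s'))) (π∘p2V (src G d)) in
      no-node-loop G d (sym tgt≡src) (subst (T ∘ isNodeV G) tgt≡src (subst (T ∘ isNodeV Cg) (sym t) nd))
    copies-notAtSameNode n d p ns nt fx (inj₂ t) (inj₂ t') nd =
      let tgtOut = p2V-first⇒outside (trans t' (sym t)) in
      tgtOut (Edge⇒inB G (proj₂ (box-fixed o d ns nt fx (inj₁ (inB⇒Edge G (touch-src p tgtOut))))))

    π-injective-atNode : ∀ n e e' → NonBang Cg (cSrc G b e) → NonBang Cg (cTgt G b e) →
      IsFixed Cg e → Incident Cg n e → Incident Cg n e' → T (isNodeV Cg n) → πE e ≡ πE e' → e ≡ e'
    π-injective-atNode n (inj₁ d) (inj₁ d') _ _ _ _ _ _ eq = cong inj₁ eq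
    π-injective-atNode n (inj₂ (d , _)) (inj₂ (d' , _)) _ _ _ _ _ _ eq = cong inj₂ (Σ-≡ eq)
    π-injective-atNode n (inj₁ d) (inj₂ (d , p)) ns nt fx i i' nd refl =
      ⊥-elim (copies-notAtSameNode n d p ns nt fx i i' nd)
    π-injective-atNode n (inj₂ (d , p)) (inj₁ d) ns nt fx i i' nd refl =
      ⊥-elim (copies-notAtSameNode n d p (subst (NonBang G) (π∘p2V (src G d)) (nonBang-π (p2V G b (src G d)) ns))
        (subst (NonBang G) (π∘p2V (tgt G d)) (nonBang-π (p2V G b (tgt G d)) nt)) fx i' i nd)

    liftIncident : ∀ n d → Incident G (πV n) d → Σ (CE G b) λ e → Incident Cg n e × πE e ≡ d
    liftIncident n d (inj₁ s) = let (e , s' , pe) = liftSrc n d s in e , inj₁ s' , pe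
    liftIncident n d (inj₂ t) = let (e , t' , pe) = liftTgt n d t in e , inj₂ t' , pe

    nonBang-srcLift : ∀ e {d} → πE e ≡ d → NonBang G (src G d) → NonBang Cg (cSrc G b e)
    nonBang-srcLift e refl n = nonBang-π⁻ (cSrc G b e) (subst (NonBang G) (src-π e) n)

    nonBang-tgtLift : ∀ e {d} → πE e ≡ d → NonBang G (tgt G d) → NonBang Cg (cTgt G b e)
    nonBang-tgtLift e refl n = nonBang-π⁻ (cTgt G b e) (subst (NonBang G) (tgt-π e) n)

    type-lift : ∀ e {d} → πE e ≡ d → cTyE G b e ≡ tyE G d
    type-lift e refl = sym (tyE-comm π e)

    copyStringOn : (P : CV G b → Set) (P' : V G → Set) → (∀ x → P x → NonBang Cg x) → (∀ x → P x → P' (πV x)) →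
      StringOn G P' →
      (∀ n → P n → T (isNodeV Cg n) → ∀ d → IsFixed G d → P' (src G d) → P' (tgt G d) → Incident G (πV n) d →
         Σ (CE G b) λ e → P (cSrc G b e) × P (cTgt G b e) × Incident Cg n e × cTyE G b e ≡ tyE G d) →
      StringOn Cg P
    copyStringOn P P' nonBang maps str liftFixed = stringOn-pullback π P P' maps str
      (λ n _ nd e e' a c _ _ fx _ i i' eq → π-injective-atNode n e e' (nonBang _ a) (nonBang _ c) fx i i' nd eq)
      (λ w _ wi e e' a a' t t' eq → π-injective-wireIn e e' (nonBang _ a) (nonBang _ a') (trans t (sym t'))
         (subst (T ∘ isWireV Cg) (sym t) wi) eq)
      (λ w _ wi e e' a a' t t' eq → π-injective-wireOut e e' (nonBang _ a) (nonBang _ a') (trans t (sym t'))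
         (subst (T ∘ isWireV Cg) (sym t) wi) eq)
      liftFixed

    copy-string : StringOn Cg (NonBang Cg)
    copy-string = copyStringOn (NonBang Cg) (NonBang G) (λ _ nb → nb) nonBang-π (bang-string bg)
      (λ n _ _ d _ ns nt i → let (e , i' , pe) = liftIncident n d i in
        e , nonBang-srcLift e pe ns , nonBang-tgtLift e pe nt , i' , type-lift e pe)

    box-lift : ∀ b' y z → T (isBangV Cg b') → Edge Cg b' y → Compatible y z → Edge G (πV b') (πV z) → Edge Cg b' z
    box-lift b' y z bb' eb c g =
      let (g' , c') = edge-project eb in
      edge-lift g (compatible-trans b' y z (bang-π b' bb') g' c' c)

    copy-poset : BangPoset Cg
    copy-poset = record
      { po-unique = λ e e' bs bt s t → π-injectiveE e e' s t
          (po-unique (bang-poset bg) (πE e) (πE e')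
             (subst (T ∘ isBangV G) (sym (src-π e)) (bang-π (cSrc G b e) bs))
             (subst (T ∘ isBangV G) (sym (tgt-π e)) (bang-π (cTgt G b e) bt))
             (trans (src-π e) (trans (cong πV s) (sym (src-π e'))))
             (trans (tgt-π e) (trans (cong πV t) (sym (tgt-π e')))))
      ; po-refl = λ x bx → edge-lift (po-refl (bang-poset bg) (πV x) (bang-π x bx)) (compatible-refl x)
      ; po-trans = λ x y z bx by bz e₁ e₂ →
          let (g₁ , c₁) = edge-project e₁
              (g₂ , c₂) = edge-project e₂ in
          edge-lift (po-trans (bang-poset bg) _ _ _ (bang-π x bx) (bang-π y by) (bang-π z bz) g₁ g₂)
            (compatible-trans x y z (bang-π x bx) g₁ c₁ c₂)
      ; po-antisym = λ x y bx by e₁ e₂ →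
          π-injective x y (po-antisym (bang-poset bg) _ _ (bang-π x bx) (bang-π y by)
            (proj₁ (edge-project e₁)) (proj₁ (edge-project e₂))) (proj₂ (edge-project e₁))
      }

    copy-nested : ∀ b₁ b₂ → T (isBangV Cg b₁) → T (isBangV Cg b₂) → Edge Cg b₁ b₂ → ∀ v → Edge Cg b₂ v → Edge Cg b₁ v
    copy-nested b₁ b₂ bb₁ bb₂ e₁ v e₂ =
      let (g₁ , c₁) = edge-project e₁
          (g₂ , c₂) = edge-project e₂ in
      edge-lift (bang-nested bg _ _ (bang-π b₁ bb₁) (bang-π b₂ bb₂) g₁ _ g₂)
        (compatible-trans b₁ b₂ v (bang-π b₁ bb₁) g₁ c₁ c₂)

    copy-wiresIncident : WiresIncident G → WiresIncident Cg
    copy-wiresIncident wires w nb wi =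
      let (d , ns , nt , i) = wires (πV w) (nonBang-π w nb) (wire-π w wi)
          (e , i' , pe) = liftIncident w d i in
      e , nonBang-srcLift e pe ns , nonBang-tgtLift e pe nt , i'

    -- every box of COPY_b(G) is open, since its image box in G is open and
    -- π is a local isomorphism on compatible pairs
    module _ (b' : CV G b) (bb' : T (isBangV Cg b')) where
      private
        o' = bang-open bg (πV b') (bang-π b' bb')

        atSrc : ∀ e {d x} → πE e ≡ d → Edge G x (src G d) → Edge G x (πV (cSrc G b e))
        atSrc e refl = subst (Edge G _) (src-π e)

        atTgt : ∀ e {d x} → πE e ≡ d → Edge G x (tgt G d) → Edge G x (πV (cTgt G b e))
        atTgt e refl = subst (Edge G _) (tgt-π e)

        bothEnds : ∀ n e → Edge Cg b' n → Incident Cg n e →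
          Edge G (πV b') (πV (cSrc G b e)) → Edge G (πV b') (πV (cTgt G b e)) →
          Edge Cg b' (cSrc G b e) × Edge Cg b' (cTgt G b e)
        bothEnds n e en (inj₁ refl) gs gt = en , box-lift b' _ _ bb' en (compatible-edge e) gt
        bothEnds n e en (inj₂ refl) gs gt = box-lift b' _ _ bb' en (compatible-sym _ _ (compatible-edge e)) gs , en

        projectSrc : ∀ e → Edge Cg b' (cSrc G b e) → Edge G (πV b') (src G (πE e))
        projectSrc e eb = subst (Edge G _) (sym (src-π e)) (proj₁ (edge-project eb))

        projectTgt : ∀ e → Edge Cg b' (cTgt G b e) → Edge G (πV b') (tgt G (πE e))
        projectTgt e eb = subst (Edge G _) (sym (tgt-π e)) (proj₁ (edge-project eb))

        nonBangSrc : ∀ e → NonBang Cg (cSrc G b e) → NonBang G (src G (πE e))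
        nonBangSrc e n = subst (NonBang G) (sym (src-π e)) (nonBang-π (cSrc G b e) n)

        nonBangTgt : ∀ e → NonBang Cg (cTgt G b e) → NonBang G (tgt G (πE e))
        nonBangTgt e n = subst (NonBang G) (sym (tgt-π e)) (nonBang-π (cTgt G b e) n)

        fixed-π : ∀ e → IsFixed Cg e → IsFixed G (πE e)
        fixed-π e = subst id (sym (fixed-pres π e))

        noWireOut : ∀ e → NonBang Cg (cSrc G b e) → NonBang Cg (cTgt G b e) →
          Edge Cg b' (cSrc G b e) → ¬ Edge Cg b' (cTgt G b e) → T (isWireV Cg (cTgt G b e)) → ⊥
        noWireOut e ns nt eb neb wi with T? (inB G (πV b') (πV (cTgt G b e)))
        ... | yes h = neb (box-lift b' _ _ bb' eb (compatible-edge e) (inB⇒Edge G h))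
        ... | no nh = box-noWireOut o' (πE e) (nonBangSrc e ns) (nonBangTgt e nt) (projectSrc e eb)
            (λ ed → nh (Edge⇒inB G (subst (Edge G _) (tgt-π e) ed)))
            (subst (T ∘ isWireV G) (sym (tgt-π e)) (wire-π (cTgt G b e) wi))

        noWireIn : ∀ e → NonBang Cg (cSrc G b e) → NonBang Cg (cTgt G b e) →
          Edge Cg b' (cTgt G b e) → ¬ Edge Cg b' (cSrc G b e) → T (isWireV Cg (cSrc G b e)) → ⊥
        noWireIn e ns nt eb neb wi with T? (inB G (πV b') (πV (cSrc G b e)))
        ... | yes h = neb (box-lift b' _ _ bb' eb (compatible-sym _ _ (compatible-edge e)) (inB⇒Edge G h))
        ... | no nh = box-noWireIn o' (πE e) (nonBangSrc e ns) (nonBangTgt e nt) (projectTgt e eb)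
            (λ ed → nh (Edge⇒inB G (subst (Edge G _) (src-π e) ed)))
            (subst (T ∘ isWireV G) (sym (src-π e)) (wire-π (cSrc G b e) wi))

        fixedInside : ∀ e → NonBang Cg (cSrc G b e) → NonBang Cg (cTgt G b e) → IsFixed Cg e →
          Edge Cg b' (cSrc G b e) ⊎ Edge Cg b' (cTgt G b e) → Edge Cg b' (cSrc G b e) × Edge Cg b' (cTgt G b e)
        fixedInside e ns nt fx (inj₁ eb) =
          let (_ , gt) = box-fixed o' (πE e) (nonBangSrc e ns) (nonBangTgt e nt) (fixed-π e fx) (inj₁ (projectSrc e eb)) in
          eb , box-lift b' _ _ bb' eb (compatible-edge e) (subst (Edge G _) (tgt-π e) gt)
        fixedInside e ns nt fx (inj₂ eb) =
          let (gs , _) = box-fixed o' (πE e) (nonBangSrc e ns) (nonBangTgt e nt) (fixed-π e fx) (inj₂ (projectTgt e eb)) in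
          box-lift b' _ _ bb' eb (compatible-sym _ _ (compatible-edge e)) (subst (Edge G _) (src-π e) gs) , eb

      copy-open : OpenBox Cg b'
      copy-open = record
        { box-string = copyStringOn (λ x → NonBang Cg x × Edge Cg b' x) (λ v → NonBang G v × Edge G (πV b') v)
            (λ _ → proj₁) (λ x (nb , eb) → nonBang-π x nb , proj₁ (edge-project eb)) (box-string o')
            (λ n (_ , en) _ d _ (ns , es) (nt , et) inc →
              let (e , i , pe) = liftIncident n d inc
                  (bs , bt) = bothEnds n e en i (atSrc e pe es) (atTgt e pe et) in
              e , (nonBang-srcLift e pe ns , bs) , (nonBang-tgtLift e pe nt , bt) , i , type-lift e pe)
        ; box-noWireOut = noWireOut
        ; box-noWireIn = noWireIn
        ; box-fixed = fixedInside
        }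

    copy-bangGraph : BangGraph Cg
    copy-bangGraph = record
      { bang-string = copy-string
      ; bang-poset = copy-poset
      ; bang-open = copy-open
      ; bang-nested = copy-nested
      }

  module CopyMorphism {I L : TGraph S} (i : Hom I L) (emb : BoundaryEmbedding i) (b : V I) (bb : T (isBangV I b)) where
    bL = fV i b
    module CI = CopyBasics I b
    module CL = CopyBasics L bL

    inB-map : ∀ {x} → T (inB I b x) → T (inB L bL (fV i x))
    inB-map h = Edge⇒inB L (edge-pres i (inB⇒Edge I h))

    inB-reflect : ∀ x → T (inB L bL (fV i x)) → T (inB I b x)
    inB-reflect x h = Edge⇒inB I (embedding-reflectsBox i emb bb (inB⇒Edge L h))

    touch-map : ∀ e → T (touchB I b e) → T (touchB L bL (fE i e))
    touch-map e t with ∨-cases t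
    ... | inj₁ p = ∨-inl (subst (T ∘ inB L bL) (sym (src-comm i e)) (inB-map p))
    ... | inj₂ p = ∨-inr {inB L bL (src L (fE i e))} (subst (T ∘ inB L bL) (sym (tgt-comm i e)) (inB-map p))

    touch-reflect : ∀ e → T (touchB L bL (fE i e)) → T (touchB I b e)
    touch-reflect e t with ∨-cases t
    ... | inj₁ p = ∨-inl (inB-reflect _ (subst (T ∘ inB L bL) (src-comm i e) p))
    ... | inj₂ p = ∨-inr {inB I b (src I e)} (inB-reflect _ (subst (T ∘ inB L bL) (tgt-comm i e) p))

    copyV : CV I b → CV L bL
    copyV (inj₁ x) = inj₁ (fV i x)
    copyV (inj₂ (x , p)) = inj₂ (fV i x , inB-map p)

    copyE : CE I b → CE L bL
    copyE (inj₁ e) = inj₁ (fE i e)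
    copyE (inj₂ (e , t)) = inj₂ (fE i e , touch-map e t)

    copy-p2V : ∀ u → copyV (p2V I b u) ≡ p2V L bL (fV i u)
    copy-p2V u with CI.p2V-cases u
    ... | inj₁ (out , eq) rewrite eq = sym (CL.p2V-out (fV i u) (out ∘ inB-reflect u))
    ... | inj₂ (p , eq) rewrite eq = sym (CL.p2V-in (fV i u) _)

    copy-p2E : ∀ e → copyE (p2E I b e) ≡ p2E L bL (fE i e)
    copy-p2E e with CI.p2E-cases e | CL.p2E-cases (fE i e)
    ... | inj₁ (_ , eq) | inj₁ (_ , eq') rewrite eq | eq' = refl
    ... | inj₁ (out , _) | inj₂ (t' , _) = ⊥-elim (out (touch-reflect e t'))
    ... | inj₂ (t , _) | inj₁ (out' , _) = ⊥-elim (out' (touch-map e t))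
    ... | inj₂ (_ , eq) | inj₂ (_ , eq') rewrite eq | eq' = cong inj₂ (Σ-≡ refl)

    copyHom : Hom (COPY I b) (COPY L bL)
    copyHom = record
      { fV = copyV ; fE = copyE
      ; src-comm = λ { (inj₁ e) → cong inj₁ (src-comm i e)
                     ; (inj₂ (e , _)) → trans (cong (p2V L bL) (src-comm i e)) (sym (copy-p2V (src I e))) }
      ; tgt-comm = λ { (inj₁ e) → cong inj₁ (tgt-comm i e)
                     ; (inj₂ (e , _)) → trans (cong (p2V L bL) (tgt-comm i e)) (sym (copy-p2V (tgt I e))) }
      ; tyV-comm = λ { (inj₁ x) → tyV-comm i x ; (inj₂ (x , _)) → tyV-comm i x }
      ; tyE-comm = λ { (inj₁ e) → tyE-comm i e ; (inj₂ (e , _)) → tyE-comm i e }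
      }

    copyHom-isCOPYMor : IsCOPYMor i b copyHom
    copyHom-isCOPYMor = (λ _ → refl) , (λ _ → refl) , copy-p2V , copy-p2E

    π∘copyV : ∀ x → CL.πV (copyV x) ≡ fV i (CI.πV x)
    π∘copyV (inj₁ _) = refl
    π∘copyV (inj₂ _) = refl

    π∘copyE : ∀ e → CL.πE (copyE e) ≡ fE i (CI.πE e)
    π∘copyE (inj₁ _) = refl
    π∘copyE (inj₂ _) = refl

    private
      injV : ∀ x y → copyV x ≡ copyV y → x ≡ y
      injV (inj₁ x) (inj₁ y) eq = cong inj₁ (emb-injV emb x y (cong CL.πV eq))
      injV (inj₂ (x , _)) (inj₂ (y , _)) eq = cong inj₂ (Σ-≡ (emb-injV emb x y (cong CL.πV eq)))
      injV (inj₁ _) (inj₂ _) ()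
      injV (inj₂ _) (inj₁ _) ()

      injE : ∀ x y → copyE x ≡ copyE y → x ≡ y
      injE (inj₁ x) (inj₁ y) eq = cong inj₁ (emb-injE emb x y (cong CL.πE eq))
      injE (inj₂ (x , _)) (inj₂ (y , _)) eq = cong inj₂ (Σ-≡ (emb-injE emb x y (cong CL.πE eq)))
      injE (inj₁ _) (inj₂ _) ()
      injE (inj₂ _) (inj₁ _) ()

      preimageV : ∀ y → Boundary (COPY L bL) y → Σ (CV I b) λ x → copyV x ≡ y
      preimageV (inj₁ v) bd = let (x , eq) = emb-preimageV emb v (CL.boundary-π bd) in inj₁ x , cong inj₁ eq
      preimageV (inj₂ (v , p)) bd = let (x , eq) = emb-preimageV emb v (CL.boundary-π bd) in
        inj₂ (x , inB-reflect x (subst (T ∘ inB L bL) (sym eq) p)) , cong inj₂ (Σ-≡ eq)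

      bangE : ∀ e → T (isBangV (COPY L bL) (cSrc L bL (copyE e)))
      bangE e = CL.bang-π⁻ (cSrc L bL (copyE e)) (subst (T ∘ isBangV L) (CL.src-π (copyE e))
        (subst (λ z → T (isBangV L (src L z))) (sym (π∘copyE e)) (emb-bangE emb (CI.πE e))))

      preimageE : ∀ y → T (isBangV (COPY L bL) (cSrc L bL y)) → Boundary (COPY L bL) (cTgt L bL y) →
        Σ (CE I b) λ x → copyE x ≡ y
      preimageE y bs bt with emb-preimageE emb (CL.πE y)
                               (subst (T ∘ isBangV L) (sym (CL.src-π y)) (CL.bang-π (cSrc L bL y) bs))
                               (subst (Boundary L) (sym (CL.tgt-π y)) (CL.boundary-π bt))
      preimageE (inj₁ d) _ _ | x , eq = inj₁ x , cong inj₁ eq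
      preimageE (inj₂ (d , t)) _ _ | x , eq =
        inj₂ (x , touch-reflect x (subst (T ∘ touchB L bL) (sym eq) t)) , cong inj₂ (Σ-≡ eq)

    copy-embedding : BoundaryEmbedding copyHom
    copy-embedding = record
      { emb-injV = injV
      ; emb-injE = injE
      ; emb-boundaryV = λ x → CL.boundary-π⁻ (subst (Boundary L) (sym (π∘copyV x)) (emb-boundaryV emb (CI.πV x)))
      ; emb-preimageV = preimageV
      ; emb-bangE = bangE
      ; emb-preimageE = preimageE
      }

    copy-inBoundary : ∀ x → InBoundary (COPY L bL) (copyV x) → InBoundary L (fV i (CI.πV x))
    copy-inBoundary x h = subst (InBoundary L) (π∘copyV x) (CL.inBoundary-π h)

    copy-inBoundary⁻ : ∀ x → InBoundary L (fV i (CI.πV x)) → InBoundary (COPY L bL) (copyV x)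
    copy-inBoundary⁻ x h = CL.inBoundary-π⁻ (subst (InBoundary L) (sym (π∘copyV x)) h)

    copy-outBoundary : ∀ x → OutBoundary (COPY L bL) (copyV x) → OutBoundary L (fV i (CI.πV x))
    copy-outBoundary x h = subst (OutBoundary L) (π∘copyV x) (CL.outBoundary-π h)

    copy-outBoundary⁻ : ∀ x → OutBoundary L (fV i (CI.πV x)) → OutBoundary (COPY L bL) (copyV x)
    copy-outBoundary⁻ x h = CL.outBoundary-π⁻ (subst (OutBoundary L) (sym (π∘copyV x)) h)

  module _ {L I R : TGraph S} (i₁ : Hom I L) (i₂ : Hom I R) (ch : EquationChar i₁ i₂)
    (b : V I) (bb : T (isBangV I b)) where
    private
      module Copy₁ = CopyMorphism i₁ (ch-emb₁ ch) b bb
      module Copy₂ = CopyMorphism i₂ (ch-emb₂ ch) b bb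

    copyEquation : EquationChar Copy₁.copyHom Copy₂.copyHom
    copyEquation = record
      { ch-L = CopyBangGraph.copy-bangGraph L (ch-L ch) _ (subst T (sym (bang-pres i₁ b)) bb)
      ; ch-I = CopyBangGraph.copy-bangGraph I (ch-I ch) b bb
      ; ch-R = CopyBangGraph.copy-bangGraph R (ch-R ch) _ (subst T (sym (bang-pres i₂ b)) bb)
      ; ch-Lwires = CopyBangGraph.copy-wiresIncident L (ch-L ch) _ (subst T (sym (bang-pres i₁ b)) bb) (ch-Lwires ch)
      ; ch-Rwires = CopyBangGraph.copy-wiresIncident R (ch-R ch) _ (subst T (sym (bang-pres i₂ b)) bb) (ch-Rwires ch)
      ; ch-emb₁ = Copy₁.copy-embedding
      ; ch-emb₂ = Copy₂.copy-embedding
      ; ch-in→ = λ x h → Copy₂.copy-inBoundary⁻ x (ch-in→ ch _ (Copy₁.copy-inBoundary x h))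
      ; ch-in← = λ x h → Copy₁.copy-inBoundary⁻ x (ch-in← ch _ (Copy₂.copy-inBoundary x h))
      ; ch-out→ = λ x h → Copy₂.copy-outBoundary⁻ x (ch-out→ ch _ (Copy₁.copy-outBoundary x h))
      ; ch-out← = λ x h → Copy₁.copy-outBoundary⁻ x (ch-out← ch _ (Copy₂.copy-outBoundary x h))
      }

theorem5p8 : (Tsig : Sig) (L I R : TGraph Tsig) (i₁ : Hom I L) (i₂ : Hom I R) →
    IsEquation i₁ i₂ →
    (b : V I) → T (isBangV I b) →
    -- COPY
    (Σ (Hom (COPY I b) (COPY L (fV i₁ b))) λ g₁ →
     Σ (Hom (COPY I b) (COPY R (fV i₂ b))) λ g₂ →
       IsCOPYMor i₁ b g₁ × IsCOPYMor i₂ b g₂ × IsEquation g₁ g₂) ×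
    -- DROP
    (Σ (Hom (DROP I b) (DROP L (fV i₁ b))) λ g₁ →
     Σ (Hom (DROP I b) (DROP R (fV i₂ b))) λ g₂ →
       IsRestriction (dropP I b) (allE I) (dropP L (fV i₁ b)) (allE L) i₁ g₁ ×
       IsRestriction (dropP I b) (allE I) (dropP R (fV i₂ b)) (allE R) i₂ g₂ ×
       IsEquation g₁ g₂) ×
    -- KILL
    (Σ (Hom (KILL I b) (KILL L (fV i₁ b))) λ g₁ →
     Σ (Hom (KILL I b) (KILL R (fV i₂ b))) λ g₂ →
       IsRestriction (killP I b) (allE I) (killP L (fV i₁ b)) (allE L) i₁ g₁ ×
       IsRestriction (killP I b) (allE I) (killP R (fV i₂ b)) (allE R) i₂ g₂ ×
       IsEquation g₁ g₂)
theorem5p8 Tsig L I R i₁ i₂ eq b bb =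
  (Copy₁.copyHom , Copy₂.copyHom , Copy₁.copyHom-isCOPYMor , Copy₂.copyHom-isCOPYMor ,
     char⇒equation _ _ (copyEquation i₁ i₂ ch b bb)) ,
  dropEquation i₁ i₂ ch b bb ,
  killEquation i₁ i₂ ch b bb
  where
  ch = equation⇒char i₁ i₂ eq
  module Copy₁ = CopyMorphism i₁ (ch-emb₁ ch) b bb
  module Copy₂ = CopyMorphism i₂ (ch-emb₂ ch) b bb
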